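{- For every odd integer $\Delta\geq 11$ there is a chordal graph $G$ with tree-width $2$, maximum degree $\Delta$, and tree-partition-width $\mathrm{tpw}(G)\geq\tfrac{2}{3}(\Delta-1)$.
   Context: All graphs are finite, simple and undirected. A graph is chordal if every induced cycle is a triangle. A graph $H$ is a partition of a graph $G$ if each vertex of $H$ (called a bag) is a set of vertices of $G$, every vertex of $G$ lies in exactly one bag, and distinct bags $A,B$ are adjacent in $H$ if and only if some edge of $G$ has one endpoint in $A$ and the other in $B$. The width of a partition is the maximum number of vertices in a bag. If a forest $T$ is a partition of $G$, then $T$ is a tree-partition of $G$. The tree-partition-width $\mathrm{tpw}(G)$ is the minimum width of a tree-partition of $G$. -}

module Defs where

open import Data.Nat using (ℕ; zero; suc; _+_; _*_; _∸_; _≤_)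
open import Data.Fin using (Fin; toℕ)
import Data.Fin as F
open import Data.Bool using (Bool; true; false; if_then_else_)
open import Data.Product using (Σ; _×_; _,_; ∃)
open import Data.Sum using (_⊎_)
open import Relation.Binary.PropositionalEquality using (_≡_; _≢_)
open import Relation.Nullary using (¬_)
open import Function.Definitions using (Injective)
open import Data.Fin using (_≟_)
open import Relation.Nullary.Decidable using (⌊_⌋)

record Graph (n : ℕ) : Set where
  field
    adj    : Fin n → Fin n → Bool
    sym    : ∀ u v → adj u v ≡ adj v u
    irrefl : ∀ v → adj v v ≡ false
open Graph public

count : {n : ℕ} → (Fin n → Bool) → ℕ
count {zero}  P = 0
count {suc n} P = (if P F.zero then 1 else 0) + count {n} (λ i → P (F.suc i))

degree : {n : ℕ} → Graph n → Fin n → ℕ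
degree G u = count (adj G u)

MaxDegree : {n : ℕ} → Graph n → ℕ → Set
MaxDegree {n} G Δ = (∀ u → degree G u ≤ Δ) × ∃ (λ u → degree G u ≡ Δ)

CycAdj : (k : ℕ) → Fin k → Fin k → Set
CycAdj k i j =
    (suc (toℕ i) ≡ toℕ j)
  ⊎ (suc (toℕ j) ≡ toℕ i)
  ⊎ (toℕ i ≡ 0 × suc (toℕ j) ≡ k)
  ⊎ (toℕ j ≡ 0 × suc (toℕ i) ≡ k)

IsInducedCycle : {n : ℕ} → Graph n → (k : ℕ) → (Fin k → Fin n) → Set
IsInducedCycle G k c =
  (3 ≤ k) × Injective _≡_ _≡_ c ×
  (∀ i j → (adj G (c i) (c j) ≡ true → CycAdj k i j)
         × (CycAdj k i j → adj G (c i) (c j) ≡ true))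

Chordal : {n : ℕ} → Graph n → Set
Chordal {n} G = ∀ (k : ℕ) (c : Fin k → Fin n) → IsInducedCycle G k c → k ≡ 3

IsCycle : {n : ℕ} → Graph n → (k : ℕ) → (Fin k → Fin n) → Set
IsCycle G k c =
  (3 ≤ k) × Injective _≡_ _≡_ c ×
  (∀ i j → CycAdj k i j → adj G (c i) (c j) ≡ true)

Forest : {n : ℕ} → Graph n → Set
Forest {n} G = ∀ (k : ℕ) (c : Fin k → Fin n) → ¬ IsCycle G k c

data PathIn {n : ℕ} (G : Graph n) (S : Fin n → Bool) : Fin n → Fin n → Set where
  here : ∀ {u} → S u ≡ true → PathIn G S u u
  step : ∀ {u w v} → S u ≡ true → adj G u w ≡ true → PathIn G S w v → PathIn G S u v

ConnectedOn : {n : ℕ} → Graph n → (Fin n → Bool) → Set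
ConnectedOn G S = ∀ u v → S u ≡ true → S v ≡ true → PathIn G S u v

Tree : {m : ℕ} → Graph m → Set
Tree {m} T = (1 ≤ m) × ConnectedOn T (λ _ → true) × Forest T

record TreeDecomposition {n : ℕ} (G : Graph n) : Set where
  field
    m        : ℕ
    T        : Graph m
    isTree   : Tree T
    bag      : Fin m → Fin n → Bool
    vcover   : ∀ v → ∃ λ t → bag t v ≡ true
    ecover   : ∀ u v → adj G u v ≡ true → ∃ λ t → (bag t u ≡ true) × (bag t v ≡ true)
    subtree  : ∀ v → ConnectedOn T (λ t → bag t v)
open TreeDecomposition public

TDWidth≤ : {n : ℕ} {G : Graph n} → TreeDecomposition G → ℕ → Set
TDWidth≤ D w = ∀ t → count (bag D t) ≤ suc w

HasTreewidth : {n : ℕ} → Graph n → ℕ → Set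
HasTreewidth G w =
    (Σ (TreeDecomposition G) λ D → TDWidth≤ D w)
  × (∀ (D : TreeDecomposition G) (w' : ℕ) → TDWidth≤ D w' → w ≤ w')

-- A partition H of G into m bags, given by the bag map f : V(G) → V(H)
-- (each vertex lies in exactly one bag), all bags nonempty, and distinct
-- bags adjacent in H iff some edge of G joins them.
record Partition {n : ℕ} (G : Graph n) : Set where
  field
    m        : ℕ
    H        : Graph m
    part     : Fin n → Fin m
    nonempty : ∀ a → ∃ λ v → part v ≡ a
    adjIff   : ∀ a b → (adj H a b ≡ true →
                          (a ≢ b) × ∃ λ u → ∃ λ v → (part u ≡ a) × (part v ≡ b) × (adj G u v ≡ true))
                     × ((a ≢ b) × (∃ λ u → ∃ λ v → (part u ≡ a) × (part v ≡ b) × (adj G u v ≡ true))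
                          → adj H a b ≡ true)
open Partition public

bagSize : {n : ℕ} {G : Graph n} (P : Partition G) → Fin (Partition.m P) → ℕ
bagSize P a = count (λ v → ⌊ part P v ≟ a ⌋)

IsTreePartition : {n : ℕ} {G : Graph n} → Partition G → Set
IsTreePartition P = Forest (H P)

{-# OPTIONS --safe #-}
-- The graph is a fan with ears: a hub joined to every vertex of a path r₀ … r_{Δ-1}, and K = (Δ - 3)/2 ears
-- on every rim edge r_j r_{j+1}.  Ordering ears < r₀ < … < r_{Δ-1} < hub, the higher neighbours of every
-- vertex form a clique, so the graph is chordal; taking as bags each vertex with its higher neighbours, along
-- the tree ear → r_j → r_{j+1} → … → hub, gives width 2, and the triangle hub r₀ r₁ forces width 2 by the
-- Helly property of subtrees.
-- No triangle meets three bags of a tree-partition.  Hence, if A is the bag of the hub, consecutive rim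
-- vertices outside A lie in a common bag C, and at each boundary between A and such a run all K ears lie in
-- A ∪ C.  If all bags had fewer than 2(Δ - 1)/3 vertices, each run would need many of its boundary ears in A
-- (or would have to contain an end of the rim), and summing over the runs makes A too large.
module Submission where

open import Defs hiding (sym)
open import Data.Nat using (ℕ; zero; suc; _+_; _*_; _∸_; _≤_; _<_; _%_; _/_; z≤n; s≤s; _≤?_; _<?_)
import Data.Nat as ℕ
open import Data.Nat.Properties hiding (_≟_)
open import Algebra.Properties.CommutativeSemigroup +-commutativeSemigroup using () renaming (interchange to +-interchange)
open import Data.Nat.DivMod using (m≡m%n+[m/n]*n)
open import Data.Nat.Induction using (<-wellFounded)
open import Data.Nat.Tactic.RingSolver using (solve-∀)
open import Induction.WellFounded using (Acc; acc)
open import Data.Fin using (Fin; toℕ; fromℕ<; _↑ˡ_; _↑ʳ_; combine; splitAt; remQuot)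
import Data.Fin as F
import Data.Fin.Properties as FP
open import Data.Fin.Patterns using (0F; 1F; 2F)
open import Data.Vec using ([]; _∷_; lookup)
open import Data.Bool using (Bool; true; false; if_then_else_; _∨_; _∧_; not)
import Data.Bool as B
open import Data.Bool.Properties using (∧-identityʳ; ∨-comm; ∨-identityʳ; ∨-zeroʳ)
open import Data.Unit using (⊤; tt)
open import Data.Empty using (⊥; ⊥-elim)
open import Data.Product using (Σ; ∃; ∃₂; _×_; _,_; proj₁; proj₂; map₂)
open import Data.Sum using (_⊎_; inj₁; inj₂)
open import Relation.Binary using (tri<; tri≈; tri>)
open import Relation.Binary.PropositionalEquality
open import Relation.Nullary using (Dec; yes; no; does; _×-dec_; _⊎-dec_; ¬?)
open import Relation.Nullary.Decidable using (dec-true; dec-false; isYes≗does)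
open import Relation.Unary using (Pred; Decidable)
open import Function using (_∘_)
open import Function.Definitions using (Injective)


-- Finite sums and counting

χ : Bool → ℕ
χ b = if b then 1 else 0

fromDoes : ∀ {A : Set} {a? : Dec A} → does a? ≡ true → A
fromDoes {a? = yes a} _ = a

sum : ∀ {n} → (Fin n → ℕ) → ℕ
sum {zero}  f = 0
sum {suc n} f = f F.zero + sum (f ∘ F.suc)

count≡sum-χ : ∀ {n} (P : Fin n → Bool) → count P ≡ sum (χ ∘ P)
count≡sum-χ {zero}  P = refl
count≡sum-χ {suc n} P = cong (χ (P F.zero) +_) (count≡sum-χ (P ∘ F.suc))

sum-cong : ∀ {n} {f g : Fin n → ℕ} → (∀ i → f i ≡ g i) → sum f ≡ sum g
sum-cong {zero}  f≗g = refl
sum-cong {suc n} f≗g = cong₂ _+_ (f≗g F.zero) (sum-cong (f≗g ∘ F.suc))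

sum-mono-≤ : ∀ {n} {f g : Fin n → ℕ} → (∀ i → f i ≤ g i) → sum f ≤ sum g
sum-mono-≤ {zero}  f≤g = z≤n
sum-mono-≤ {suc n} f≤g = +-mono-≤ (f≤g F.zero) (sum-mono-≤ (f≤g ∘ F.suc))

sum-+ : ∀ {n} (f g : Fin n → ℕ) → sum (λ i → f i + g i) ≡ sum f + sum g
sum-+ {zero}  f g = refl
sum-+ {suc n} f g = trans (cong (f F.zero + g F.zero +_) (sum-+ (f ∘ F.suc) (g ∘ F.suc)))
                          (+-interchange (f F.zero) (g F.zero) _ _)

sum-*ˡ : ∀ {n} c (f : Fin n → ℕ) → sum (λ i → c * f i) ≡ c * sum f
sum-*ˡ {zero}  c f = sym (*-zeroʳ c)
sum-*ˡ {suc n} c f = trans (cong (c * f F.zero +_) (sum-*ˡ c (f ∘ F.suc)))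
                           (sym (*-distribˡ-+ c (f F.zero) _))

sum-const : ∀ {n} c → sum {n} (λ _ → c) ≡ n * c
sum-const {zero}  c = refl
sum-const {suc n} c = cong (c +_) (sum-const {n} c)

sum-↑ : ∀ {m n} (f : Fin (m + n) → ℕ) → sum f ≡ sum (f ∘ (_↑ˡ n)) + sum (f ∘ (m ↑ʳ_))
sum-↑ {zero}      f = refl
sum-↑ {suc m} {n} f = trans (cong (f F.zero +_) (sum-↑ {m} {n} (f ∘ F.suc)))
                            (sym (+-assoc (f F.zero) _ _))

sum-combine : ∀ {m n} (f : Fin (m * n) → ℕ) → sum f ≡ sum {m} (λ i → sum {n} (λ j → f (combine i j)))
sum-combine {zero}      f = refl
sum-combine {suc m} {n} f = trans (sum-↑ {n} {m * n} f)
                                  (cong (sum (f ∘ (_↑ˡ m * n)) +_) (sum-combine {m} {n} (f ∘ (n ↑ʳ_))))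

count-cong : ∀ {n} {P Q : Fin n → Bool} → (∀ i → P i ≡ Q i) → count P ≡ count Q
count-cong {zero}  P≗Q = refl
count-cong {suc n} P≗Q = cong₂ _+_ (cong χ (P≗Q F.zero)) (count-cong (P≗Q ∘ F.suc))

count-mono : ∀ {n} {P Q : Fin n → Bool} → (∀ i → P i ≡ true → Q i ≡ true) → count P ≤ count Q
count-mono {zero}  P⊆Q = z≤n
count-mono {suc n} P⊆Q = +-mono-≤ (χ-mono (P⊆Q F.zero)) (count-mono (P⊆Q ∘ F.suc))
  where
  χ-mono : ∀ {a b} → (a ≡ true → b ≡ true) → χ a ≤ χ b
  χ-mono {false}         _   = z≤n
  χ-mono {true}  {true}  _   = ≤-refl
  χ-mono {true}  {false} a⇒b with a⇒b refl
  ... | ()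

count-∨ : ∀ {n} (P Q : Fin n → Bool) → count (λ i → P i ∨ Q i) ≤ count P + count Q
count-∨ {zero}  P Q = z≤n
count-∨ {suc n} P Q = ≤-trans (+-mono-≤ (χ-∨ (P F.zero) (Q F.zero)) (count-∨ (P ∘ F.suc) (Q ∘ F.suc)))
                              (≤-reflexive (+-interchange (χ (P F.zero)) _ _ _))
  where
  χ-∨ : ∀ a b → χ (a ∨ b) ≤ χ a + χ b
  χ-∨ false b = ≤-refl
  χ-∨ true  b = s≤s z≤n

count-none : ∀ {n} {P : Fin n → Bool} → (∀ i → P i ≡ false) → count P ≡ 0
count-none {zero}  none = refl
count-none {suc n} none rewrite none F.zero = count-none (none ∘ F.suc)

count-unique : ∀ {n ℓ} {P : Pred (Fin n) ℓ} (P? : Decidable P) →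
               (∀ {i j} → P i → P j → i ≡ j) → count (does ∘ P?) ≤ 1
count-unique {zero}  P? unique = z≤n
count-unique {suc n} P? unique with P? F.zero
... | no  _  = count-unique (P? ∘ F.suc) (λ p q → FP.suc-injective (unique p q))
... | yes p₀ = ≤-reflexive (cong suc (count-none λ i → dec-false (P? (F.suc i)) (λ p → 0≢suc (unique p₀ p))))
  where
  0≢suc : ∀ {i : Fin n} → F.zero ≢ F.suc i
  0≢suc ()

count-≟ : ∀ {n} (a : Fin n) → count (λ v → does (v F.≟ a)) ≡ 1
count-≟ {suc n} F.zero = cong suc (count-none {n} λ _ → refl)
count-≟ (F.suc a)      = count-≟ a

count-remove : ∀ {n} (P : Fin n → Bool) {a} → P a ≡ true →
               count P ≡ suc (count (λ v → P v ∧ not (does (v F.≟ a))))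
count-remove {suc n} P {F.zero} Pa rewrite Pa =
  cong suc (count-cong λ i → sym (∧-identityʳ (P (F.suc i))))
count-remove {suc n} P {F.suc a} Pa = begin
  χ (P F.zero) + count (P ∘ F.suc)             ≡⟨ cong (χ (P F.zero) +_) (count-remove (P ∘ F.suc) Pa) ⟩
  χ (P F.zero) + suc rest                      ≡⟨ +-suc (χ (P F.zero)) rest ⟩
  suc (χ (P F.zero) + rest)                    ≡⟨ cong (λ b → suc (χ b + rest)) (sym (∧-identityʳ (P F.zero))) ⟩
  suc (χ (P F.zero ∧ true) + rest)             ∎
  where
  rest = count (λ v → P (F.suc v) ∧ not (does (v F.≟ a)))
  open ≡-Reasoning

count-three : ∀ {n} (P : Fin n → Bool) {a b c} → a ≢ b → a ≢ c → b ≢ c →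
              P a ≡ true → P b ≡ true → P c ≡ true → 3 ≤ count P
count-three {n} P {a} {b} {c} a≢b a≢c b≢c Pa Pb Pc =
  ≤-trans (s≤s (s≤s (s≤s z≤n)))
    (≤-reflexive (sym (trans (count-remove P Pa)
                        (cong suc (trans (count-remove P₁ P₁b) (cong suc (count-remove P₂ P₂c)))))))
  where
  P₁ P₂ : Fin n → Bool
  P₁ v = P v ∧ not (does (v F.≟ a))
  P₂ v = P₁ v ∧ not (does (v F.≟ b))
  P₁b : P₁ b ≡ true
  P₁b rewrite Pb | dec-false (b F.≟ a) (a≢b ∘ sym) = refl
  P₂c : P₂ c ≡ true
  P₂c rewrite Pc | dec-false (c F.≟ a) (a≢c ∘ sym) | dec-false (c F.≟ b) (b≢c ∘ sym) = refl

count-const : ∀ {n} b → count {n} (λ _ → b) ≡ n * χ b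
count-const {n} b = trans (count≡sum-χ {n} (λ _ → b)) (sum-const {n} (χ b))

true≢false : true ≢ false
true≢false ()

-- Cycles, elimination orders and forests

argmin : ∀ {k} (r : Fin (suc k) → ℕ) → ∃ λ i → ∀ j → r i ≤ r j
argmin {zero}  r = F.zero , λ { F.zero → ≤-refl }
argmin {suc k} r with argmin (r ∘ F.suc)
... | i , min with r F.zero ≤? r (F.suc i)
...   | yes r₀≤ = F.zero  , λ { F.zero → ≤-refl ; (F.suc j) → ≤-trans r₀≤ (min j) }
...   | no  r₀≰ = F.suc i , λ { F.zero → <⇒≤ (≰⇒> r₀≰) ; (F.suc j) → min j }

-- CycAdj k i j unfolds to CycAdjℕ k (toℕ i) (toℕ j).
CycAdjℕ : ℕ → ℕ → ℕ → Set
CycAdjℕ k x y = (suc x ≡ y) ⊎ (suc y ≡ x) ⊎ (x ≡ 0 × suc y ≡ k) ⊎ (y ≡ 0 × suc x ≡ k)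

record CyclicNeighbours (k t : ℕ) : Set where
  field
    prev next   : ℕ
    prev<k      : prev < k
    next<k      : next < k
    t~prev      : CycAdjℕ k t prev
    t~next      : CycAdjℕ k t next
    prev≢next   : prev ≢ next
    prev~next⇒3 : CycAdjℕ k prev next → k ≡ 3

cyclicNeighbours : ∀ m t → t < 3 + m → CyclicNeighbours (3 + m) t
cyclicNeighbours m zero _ = record
  { prev = 2 + m ; next = 1 ; prev<k = ≤-refl ; next<k = s≤s (s≤s z≤n)
  ; t~prev = inj₂ (inj₂ (inj₁ (refl , refl))) ; t~next = inj₁ refl
  ; prev≢next = λ () ; prev~next⇒3 = ends }
  where
  ends : CycAdjℕ (3 + m) (2 + m) 1 → 3 + m ≡ 3
  ends (inj₂ (inj₁ 2≡2+m))       = cong suc (sym 2≡2+m)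
  ends (inj₁ ())
  ends (inj₂ (inj₂ (inj₁ (() , _))))
  ends (inj₂ (inj₂ (inj₂ (() , _))))
cyclicNeighbours m (suc b) t<k with 2 + b <? 3 + m
... | yes 2+b<k = record
  { prev = b ; next = 2 + b ; prev<k = <-trans (n<1+n b) t<k ; next<k = 2+b<k
  ; t~prev = inj₂ (inj₁ refl) ; t~next = inj₁ refl
  ; prev≢next = λ () ; prev~next⇒3 = gap }
  where
  gap : CycAdjℕ (3 + m) b (2 + b) → 3 + m ≡ 3
  gap (inj₁ ())
  gap (inj₂ (inj₁ ()))
  gap (inj₂ (inj₂ (inj₁ (refl , 3≡3+m)))) = sym 3≡3+m
  gap (inj₂ (inj₂ (inj₂ (() , _))))
... | no  2+b≮k = record
  { prev = b ; next = 0 ; prev<k = <-trans (n<1+n b) t<k ; next<k = s≤s z≤n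
  ; t~prev = inj₂ (inj₁ refl) ; t~next = inj₂ (inj₂ (inj₂ (refl , sym last)))
  ; prev≢next = λ b≡0 → k≢2 (trans last (cong (2 +_) b≡0))
  ; prev~next⇒3 = wrap }
  where
  last : 3 + m ≡ 2 + b
  last = ≤-antisym (≮⇒≥ 2+b≮k) t<k
  k≢2 : 3 + m ≢ 2
  k≢2 ()
  wrap : CycAdjℕ (3 + m) b 0 → 3 + m ≡ 3
  wrap (inj₁ ())
  wrap (inj₂ (inj₁ refl))                 = last
  wrap (inj₂ (inj₂ (inj₁ (refl , ()))))
  wrap (inj₂ (inj₂ (inj₂ (_ , 1+b≡k))))   =
    ⊥-elim (<-irrefl 1+b≡k (≤-trans (n<1+n (suc b)) (≤-reflexive (sym last))))

module _ {n : ℕ} (G : Graph n) (rank : Fin n → ℕ) where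

  record MinimumOnCycle (k : ℕ) (c : Fin k → Fin n) : Set where
    field
      i p s          : Fin k
      cp≢cs          : c p ≢ c s
      i~p            : adj G (c i) (c p) ≡ true
      i~s            : adj G (c i) (c s) ≡ true
      i≤p            : rank (c i) ≤ rank (c p)
      i≤s            : rank (c i) ≤ rank (c s)
      p~s⇒triangle   : CycAdj k p s → k ≡ 3

  minimumOnCycle : ∀ {k} {c : Fin k → Fin n} → IsCycle G k c → MinimumOnCycle k c
  minimumOnCycle {suc (suc (suc m))} {c} (s≤s (s≤s (s≤s _)) , c-inj , c-adj) with argmin (rank ∘ c)
  ... | i , min = record
    { i = i ; p = fromℕ< prev<k ; s = fromℕ< next<k
    ; cp≢cs = λ e → prev≢next (trans (sym (FP.toℕ-fromℕ< prev<k))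
                                  (trans (cong toℕ (c-inj e)) (FP.toℕ-fromℕ< next<k)))
    ; i~p = c-adj _ _ (toFin t~prev) ; i~s = c-adj _ _ (toFin t~next)
    ; i≤p = min _ ; i≤s = min _
    ; p~s⇒triangle = prev~next⇒3 ∘ subst₂ (CycAdjℕ (3 + m)) (FP.toℕ-fromℕ< prev<k)
                                                              (FP.toℕ-fromℕ< next<k) }
    where
    open CyclicNeighbours (cyclicNeighbours m (toℕ i) (FP.toℕ<n i))
    toFin : ∀ {y} .{y<k : y < 3 + m} → CycAdjℕ (3 + m) (toℕ i) y → CycAdj (3 + m) i (fromℕ< y<k)
    toFin {y<k = y<k} = subst (CycAdjℕ (3 + m) (toℕ i)) (sym (FP.toℕ-fromℕ< y<k))

  module RankCriteria (adj⇒rank≢ : ∀ {u v} → adj G u v ≡ true → rank u ≢ rank v) where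

    Above : Fin n → Fin n → Set
    Above v u = adj G v u ≡ true × rank v < rank u

    private
      minimumAbove : ∀ {k c} (M : MinimumOnCycle k c) → let open MinimumOnCycle M in
                     Above (c i) (c p) × Above (c i) (c s)
      minimumAbove M = (i~p , ≤∧≢⇒< i≤p (adj⇒rank≢ i~p)) , (i~s , ≤∧≢⇒< i≤s (adj⇒rank≢ i~s))
        where open MinimumOnCycle M

    perfectElimination⇒chordal :
      (∀ {v u w} → Above v u → Above v w → u ≢ w → adj G u w ≡ true) → Chordal G
    perfectElimination⇒chordal above-clique k c (3≤k , c-inj , c-adj⇔) =
      p~s⇒triangle (proj₁ (c-adj⇔ p s) (above-clique (proj₁ (minimumAbove M)) (proj₂ (minimumAbove M)) cp≢cs))
      where
      M : MinimumOnCycle k c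
      M = minimumOnCycle (3≤k , c-inj , λ i j → proj₂ (c-adj⇔ i j))
      open MinimumOnCycle M

    uniqueAbove⇒forest : (∀ {v u w} → Above v u → Above v w → u ≡ w) → Forest G
    uniqueAbove⇒forest above-unique k c cycle = cp≢cs (above-unique (proj₁ (minimumAbove M)) (proj₂ (minimumAbove M)))
      where
      M : MinimumOnCycle k c
      M = minimumOnCycle cycle
      open MinimumOnCycle M

cycAdj-irrefl : ∀ {k} (i : Fin k) → CycAdj k i i → k ≡ 1
cycAdj-irrefl i (inj₁ 1+i≡i)                 = ⊥-elim (1+n≢n 1+i≡i)
cycAdj-irrefl i (inj₂ (inj₁ 1+i≡i))          = ⊥-elim (1+n≢n 1+i≡i)
cycAdj-irrefl i (inj₂ (inj₂ (inj₁ (i≡0 , k≡)))) = trans (sym k≡) (cong suc i≡0)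
cycAdj-irrefl i (inj₂ (inj₂ (inj₂ (i≡0 , k≡)))) = trans (sym k≡) (cong suc i≡0)

forest⇒triangle-free : ∀ {m} (H : Graph m) → Forest H → ∀ {a b c} → a ≢ b → a ≢ c → b ≢ c →
                       adj H a b ≡ true → adj H a c ≡ true → adj H b c ≡ true → ⊥
forest⇒triangle-free H forest {a} {b} {c} a≢b a≢c b≢c ab ac bc =
  forest 3 v (s≤s (s≤s (s≤s z≤n)) , v-inj , v-adj)
  where
  v = lookup (a ∷ b ∷ c ∷ [])
  v-inj : Injective _≡_ _≡_ v
  v-inj {0F} {0F} _ = refl
  v-inj {1F} {1F} _ = refl
  v-inj {2F} {2F} _ = refl
  v-inj {0F} {1F} e = ⊥-elim (a≢b e)
  v-inj {0F} {2F} e = ⊥-elim (a≢c e)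
  v-inj {1F} {2F} e = ⊥-elim (b≢c e)
  v-inj {1F} {0F} e = ⊥-elim (a≢b (sym e))
  v-inj {2F} {0F} e = ⊥-elim (a≢c (sym e))
  v-inj {2F} {1F} e = ⊥-elim (b≢c (sym e))
  3≢1 : 3 ≢ 1
  3≢1 ()
  v-adj : ∀ i j → CycAdj 3 i j → adj H (v i) (v j) ≡ true
  v-adj 0F 1F _ = ab
  v-adj 0F 2F _ = ac
  v-adj 1F 2F _ = bc
  v-adj 1F 0F _ = trans (Graph.sym H b a) ab
  v-adj 2F 0F _ = trans (Graph.sym H c a) ac
  v-adj 2F 1F _ = trans (Graph.sym H c b) bc
  v-adj 0F 0F i~i = ⊥-elim (3≢1 (cycAdj-irrefl 0F i~i))
  v-adj 1F 1F i~i = ⊥-elim (3≢1 (cycAdj-irrefl 1F i~i))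
  v-adj 2F 2F i~i = ⊥-elim (3≢1 (cycAdj-irrefl 2F i~i))

module _ {m : ℕ} {T : Graph m} {S : Fin m → Bool} where

  pathIn-++ : ∀ {u v w} → PathIn T S u v → PathIn T S v w → PathIn T S u w
  pathIn-++ (here _)       Q = Q
  pathIn-++ (step u∈ u~ P) Q = step u∈ u~ (pathIn-++ P Q)

  pathIn-reverse : ∀ {u v} → PathIn T S u v → PathIn T S v u
  pathIn-reverse (here u∈) = here u∈
  pathIn-reverse {u} (step {w = w} u∈ u~w P) = pathIn-++ (pathIn-reverse P) (back (pathIn-start P))
    where
    pathIn-start : ∀ {x y} → PathIn T S x y → S x ≡ true
    pathIn-start (here x∈)     = x∈
    pathIn-start (step x∈ _ _) = x∈
    back : S w ≡ true → PathIn T S w u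
    back w∈ = step w∈ (trans (Graph.sym T _ u) u~w) (here u∈)

  connectedVia : ∀ r → (∀ t → S t ≡ true → PathIn T S t r) → ConnectedOn T S
  connectedVia r toRoot u v u∈ v∈ = pathIn-++ (toRoot u u∈) (pathIn-reverse (toRoot v v∈))

-- Walks in a forest and the Helly property of subtrees

data Split (a j : ℕ) : Set where
  before : j < a → Split a j
  after  : ∀ y → j ≡ a + y → Split a j

split : ∀ a j → Split a j
split a j with j <? a
... | yes j<a = before j<a
... | no  j≮a = after (j ∸ a) (sym (m+[n∸m]≡n (≮⇒≥ j≮a)))

data Position (lp lq lr x : ℕ) : Set where
  in-p : x < lp → Position lp lq lr x
  in-q : ∀ y → y < lq → x ≡ lp + y → Position lp lq lr x
  in-r : ∀ z → z < lr → x ≡ lp + (lq + z) → Position lp lq lr x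

position : ∀ lp lq lr {x} → x < lp + (lq + lr) → Position lp lq lr x
position lp lq lr {x} x< with split lp x
... | before x<lp = in-p x<lp
... | after y refl with split lq y
...   | before y<lq = in-q y y<lq refl
...   | after z refl = in-r z (+-cancelˡ-< lq z lr (+-cancelˡ-< lp (lq + z) (lq + lr) x<)) refl

collision-or-injective : ∀ {L m} (c : Fin L → Fin m) →
  (∃₂ λ i j → toℕ i < toℕ j × c i ≡ c j) ⊎ Injective _≡_ _≡_ c
collision-or-injective c with FP.any? (λ i → FP.any? (λ j → (toℕ i <? toℕ j) ×-dec (c i F.≟ c j)))
... | yes (i , j , i<j , e) = inj₁ (i , j , i<j , e)
... | no  none = inj₂ injective
  where
  injective : Injective _≡_ _≡_ c
  injective {i} {j} e with FP.<-cmp i j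
  ... | tri< i<j _ _ = ⊥-elim (none (i , j , i<j , e))
  ... | tri≈ _ i≡j _ = i≡j
  ... | tri> _ _ j<i = ⊥-elim (none (j , i , j<i , sym e))

module Walks {m : ℕ} (T : Graph m) where

  Steps : (ℕ → Fin m) → ℕ → Set
  Steps f l = ∀ j → j < l → adj T (f j) (f (suc j)) ≡ true

  record Walk (S : Fin m → Bool) (u v : Fin m) : Set where
    field
      len    : ℕ
      at     : ℕ → Fin m
      at-0   : at 0 ≡ u
      at-len : at len ≡ v
      steps  : Steps at len
      inside : ∀ j → j ≤ len → S (at j) ≡ true
  open Walk public

  join : (ℕ → Fin m) → ℕ → (ℕ → Fin m) → ℕ → Fin m
  join f a g j with split a j
  ... | before _  = f j
  ... | after y _ = g y

  join-< : ∀ f a g {j} → j < a → join f a g j ≡ f j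
  join-< f a g {j} j<a with split a j
  ... | before _    = refl
  ... | after y refl = ⊥-elim (<⇒≱ j<a (m≤m+n a y))

  join-+ : ∀ f a g y → join f a g (a + y) ≡ g y
  join-+ f a g y with split a (a + y)
  ... | before a+y<a = ⊥-elim (<⇒≱ a+y<a (m≤m+n a y))
  ... | after y′ e   = cong g (sym (+-cancelˡ-≡ a y y′ e))

  join-≤ : ∀ f a g {j} → g 0 ≡ f a → j ≤ a → join f a g j ≡ f j
  join-≤ f a g {j} g0≡fa j≤a with m≤n⇒m<n∨m≡n j≤a
  ... | inj₁ j<a  = join-< f a g j<a
  ... | inj₂ refl = trans (cong (join f a g) (sym (+-identityʳ a))) (trans (join-+ f a g 0) g0≡fa)

  module _ {S : Fin m → Bool} where

    start∈ : ∀ {u v} → Walk S u v → S u ≡ true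
    start∈ W = subst (λ x → S x ≡ true) (at-0 W) (inside W 0 z≤n)

    end∈ : ∀ {u v} → Walk S u v → S v ≡ true
    end∈ W = subst (λ x → S x ≡ true) (at-len W) (inside W (len W) ≤-refl)

    empty⇒≡ : ∀ {u v} (W : Walk S u v) → len W ≡ 0 → u ≡ v
    empty⇒≡ W len≡0 = trans (sym (at-0 W)) (trans (cong (at W) (sym len≡0)) (at-len W))

    fromPath : ∀ {u v} → PathIn T S u v → Walk S u v
    fromPath {u} (here u∈) = record
      { len = 0 ; at = λ _ → u ; at-0 = refl ; at-len = refl ; steps = λ _ () ; inside = λ _ _ → u∈ }
    fromPath {u} {v} (step {w = w} u∈ u~w P) = record
      { len = suc (len W) ; at = at′ ; at-0 = refl ; at-len = at-len W ; steps = steps′ ; inside = inside′ }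
      where
      W : Walk S w v
      W = fromPath P
      at′ : ℕ → Fin m
      at′ zero    = u
      at′ (suc j) = at W j
      steps′ : Steps at′ (suc (len W))
      steps′ zero    _         = subst (λ x → adj T u x ≡ true) (sym (at-0 W)) u~w
      steps′ (suc j) (s≤s j<) = steps W j j<
      inside′ : ∀ j → j ≤ suc (len W) → S (at′ j) ≡ true
      inside′ zero    _        = u∈
      inside′ (suc j) (s≤s j≤) = inside W j j≤

    subst-start : ∀ {u′ u v} → u′ ≡ u → Walk S u v → Walk S u′ v
    subst-start e W = record
      { len = len W ; at = at W ; at-0 = trans (at-0 W) (sym e) ; at-len = at-len W ; steps = steps W ; inside = inside W }

    subst-end : ∀ {u v v′} → v ≡ v′ → Walk S u v → Walk S u v′
    subst-end e W = record
      { len = len W ; at = at W ; at-0 = at-0 W ; at-len = trans (at-len W) e ; steps = steps W ; inside = inside W }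

    take : ∀ {u v} (W : Walk S u v) x → x ≤ len W → Walk S u (at W x)
    take W x x≤ = record
      { len = x ; at = at W ; at-0 = at-0 W ; at-len = refl
      ; steps = λ j j< → steps W j (<-≤-trans j< x≤) ; inside = λ j j≤ → inside W j (≤-trans j≤ x≤) }

    drop : ∀ {u v} (W : Walk S u v) x → x ≤ len W → Walk S (at W x) v
    drop W x x≤ = record
      { len = len W ∸ x ; at = λ j → at W (x + j) ; at-0 = cong (at W) (+-identityʳ x)
      ; at-len = trans (cong (at W) (m+[n∸m]≡n x≤)) (at-len W)
      ; steps = λ j j< → subst (λ k → adj T (at W (x + j)) (at W k) ≡ true) (sym (+-suc x j))
                                 (steps W (x + j) (shift j<))
      ; inside = λ j j≤ → inside W (x + j) (≤-trans (+-monoʳ-≤ x j≤) (≤-reflexive (m+[n∸m]≡n x≤))) }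
      where
      shift : ∀ {j} → j < len W ∸ x → x + j < len W
      shift j< = <-≤-trans (+-monoʳ-< x j<) (≤-reflexive (m+[n∸m]≡n x≤))

    _++_ : ∀ {u v w} → Walk S u v → Walk S v w → Walk S u w
    W ++ W′ = record
      { len = len W + len W′ ; at = joined
      ; at-0 = trans (joined-≤ z≤n) (at-0 W) ; at-len = trans (join-+ (at W) (len W) (at W′) (len W′)) (at-len W′)
      ; steps  = λ j j< → joined-steps j j< (split (len W) j)
      ; inside = λ j j≤ → joined-inside j j≤ (split (len W) j) }
      where
      joined : ℕ → Fin m
      joined = join (at W) (len W) (at W′)
      joined-≤ : ∀ {x} → x ≤ len W → joined x ≡ at W x
      joined-≤ = join-≤ (at W) (len W) (at W′) (trans (at-0 W′) (sym (at-len W)))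
      joined-steps : ∀ j → j < len W + len W′ → Split (len W) j → adj T (joined j) (joined (suc j)) ≡ true
      joined-steps j _ (before j<a) =
        subst₂ (λ x y → adj T x y ≡ true) (sym (joined-≤ (<⇒≤ j<a))) (sym (joined-≤ j<a)) (steps W j j<a)
      joined-steps _ j< (after y refl) =
        subst₂ (λ x z → adj T x z ≡ true) (sym (join-+ (at W) (len W) (at W′) y))
               (sym (trans (cong joined (sym (+-suc (len W) y))) (join-+ (at W) (len W) (at W′) (suc y))))
               (steps W′ y (+-cancelˡ-< (len W) y (len W′) j<))
      joined-inside : ∀ j → j ≤ len W + len W′ → Split (len W) j → S (joined j) ≡ true
      joined-inside j _ (before j<a) = subst (λ x → S x ≡ true) (sym (joined-≤ (<⇒≤ j<a))) (inside W j (<⇒≤ j<a))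
      joined-inside _ j≤ (after y refl) = subst (λ x → S x ≡ true) (sym (join-+ (at W) (len W) (at W′) y))
                                           (inside W′ y (+-cancelˡ-≤ (len W) y (len W′) j≤))

    at-++ˡ : ∀ {u v w} (W : Walk S u v) (W′ : Walk S v w) {x} → x ≤ len W → at (W ++ W′) x ≡ at W x
    at-++ˡ W W′ = join-≤ (at W) (len W) (at W′) (trans (at-0 W′) (sym (at-len W)))

    at-++ʳ : ∀ {u v w} (W : Walk S u v) (W′ : Walk S v w) y → at (W ++ W′) (len W + y) ≡ at W′ y
    at-++ʳ W W′ = join-+ (at W) (len W) (at W′)

    shortcut : ∀ {u v} (W : Walk S u v) {i j} → i < j → j ≤ len W → at W i ≡ at W j →
               Σ (Walk S u v) λ W′ → len W′ < len W
    shortcut W {i} {j} i<j j≤ e =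
      take W i (<⇒≤ (<-≤-trans i<j j≤)) ++ subst-start e (drop W j j≤) ,
      <-≤-trans (+-monoˡ-< (len W ∸ j) i<j) (≤-reflexive (m+[n∸m]≡n j≤))

  anywhere : Fin m → Bool
  anywhere _ = true

  forget : ∀ {S u v} → Walk S u v → Walk anywhere u v
  forget W = record
    { len = len W ; at = at W ; at-0 = at-0 W ; at-len = at-len W ; steps = steps W ; inside = λ _ _ → refl }

  closedWalk⇒cycle : ∀ {u} (W : Walk anywhere u u) → 3 ≤ len W → Injective _≡_ _≡_ (at W ∘ toℕ) →
                     IsCycle T (len W) (at W ∘ toℕ)
  closedWalk⇒cycle W 3≤ injective = 3≤ , injective , cycAdj
    where
    L : ℕ
    L = len W
    wrap : ∀ {x} → x ≡ 0 → at W L ≡ at W x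
    wrap x≡0 = trans (at-len W) (trans (sym (at-0 W)) (cong (at W) (sym x≡0)))
    step-to : ∀ (i : Fin L) {y} → suc (toℕ i) ≡ y → y ≤ L → adj T (at W (toℕ i)) (at W y) ≡ true
    step-to i e y≤ =
      subst (λ k → adj T (at W (toℕ i)) (at W k) ≡ true) e (steps W (toℕ i) (subst (_≤ L) (sym e) y≤))
    step-back : ∀ (i : Fin L) {y} → suc (toℕ i) ≡ y → y ≤ L → adj T (at W y) (at W (toℕ i)) ≡ true
    step-back i {y} e y≤ = trans (Graph.sym T (at W y) (at W (toℕ i))) (step-to i e y≤)
    cycAdj : ∀ i j → CycAdj L i j → adj T (at W (toℕ i)) (at W (toℕ j)) ≡ true
    cycAdj i j (inj₁ e)                      = step-to i e (<⇒≤ (FP.toℕ<n j))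
    cycAdj i j (inj₂ (inj₁ e))               = step-back j e (<⇒≤ (FP.toℕ<n i))
    cycAdj i j (inj₂ (inj₂ (inj₁ (i≡0 , e)))) =
      subst (λ x → adj T x (at W (toℕ j)) ≡ true) (wrap i≡0) (step-back j e ≤-refl)
    cycAdj i j (inj₂ (inj₂ (inj₂ (j≡0 , e)))) =
      subst (λ x → adj T (at W (toℕ i)) x ≡ true) (wrap j≡0) (step-to i e ≤-refl)

  -- Walks p ⊆ Sa, q ⊆ Sb, r ⊆ Sc close up a triangle.  If one of them is empty, its ends are a common
  -- vertex.  Otherwise a repeated vertex of the closed walk p q r either lies twice on one side, which can be
  -- shortcut, or on two sides, which can both be cut there; and a closed walk without repetitions is a cycle.
  module ThreeSubtrees (forest : Forest T) (Sa Sb Sc : Fin m → Bool) where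

    record WalkTriangle : Set where
      constructor triangle
      field
        {t₁ t₂ t₃} : Fin m
        p : Walk Sa t₁ t₂
        q : Walk Sb t₂ t₃
        r : Walk Sc t₃ t₁

    perimeter : WalkTriangle → ℕ
    perimeter (triangle p q r) = len p + (len q + len r)

    closed : (C : WalkTriangle) → Walk anywhere (WalkTriangle.t₁ C) (WalkTriangle.t₁ C)
    closed (triangle p q r) = forget p ++ (forget q ++ forget r)

    Shorter : WalkTriangle → Set
    Shorter C = Σ WalkTriangle λ C′ → perimeter C′ < perimeter C

    module _ {t₁ t₂ t₃} (p : Walk Sa t₁ t₂) (q : Walk Sb t₂ t₃) (r : Walk Sc t₃ t₁) where

      loop-in-p : ∀ {i j} → i < j → j ≤ len p → at p i ≡ at p j → Shorter (triangle p q r)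
      loop-in-p i<j j≤ e with shortcut p i<j j≤ e
      ... | p′ , p′< = triangle p′ q r , +-monoˡ-< (len q + len r) p′<

      loop-in-q : ∀ {i j} → i < j → j ≤ len q → at q i ≡ at q j → Shorter (triangle p q r)
      loop-in-q i<j j≤ e with shortcut q i<j j≤ e
      ... | q′ , q′< = triangle p q′ r , +-monoʳ-< (len p) (+-monoˡ-< (len r) q′<)

      loop-in-r : ∀ {i j} → i < j → j ≤ len r → at r i ≡ at r j → Shorter (triangle p q r)
      loop-in-r i<j j≤ e with shortcut r i<j j≤ e
      ... | r′ , r′< = triangle p q r′ , +-monoʳ-< (len p) (+-monoʳ-< (len q) r′<)

      p-meets-q : ∀ {i y} → i < len p → y < len q → at p i ≡ at q y → Shorter (triangle p q r)
      p-meets-q {i} {y} i< y< e =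
        triangle (take p i (<⇒≤ i<)) (subst-start e (drop q y (<⇒≤ y<))) r ,
        +-mono-<-≤ i< (+-monoˡ-≤ (len r) (m∸n≤m (len q) y))

      p-meets-r : ∀ {i z} → i < len p → z < len r → at p i ≡ at r z → Shorter (triangle p q r)
      p-meets-r {i} {z} i< z< e =
        triangle (drop p i (<⇒≤ i<)) q (subst-end (sym e) (take r z (<⇒≤ z<))) ,
        +-mono-≤-< (m∸n≤m (len p) i) (+-monoʳ-< (len q) z<)

      q-meets-r : ∀ {y z} → y < len q → z < len r → at q y ≡ at r z → Shorter (triangle p q r)
      q-meets-r {y} {z} y< z< e =
        triangle p (take q y (<⇒≤ y<)) (subst-start e (drop r z (<⇒≤ z<))) ,
        +-monoʳ-< (len p) (+-mono-<-≤ y< (m∸n≤m (len r) z))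

    shorten : (C : WalkTriangle) {i j : ℕ} → i < j → j < perimeter C → at (closed C) i ≡ at (closed C) j → Shorter C
    shorten C@(triangle p q r) i<j j<L =
      by-position (position lp lq lr (<-trans i<j j<L)) (position lp lq lr j<L) i<j
      where
      lp lq lr : ℕ
      lp = len p
      lq = len q
      lr = len r
      at-p : ∀ {x} → x ≤ lp → at (closed C) x ≡ at p x
      at-p = at-++ˡ (forget p) (forget q ++ forget r)
      at-q : ∀ {y} → y ≤ lq → at (closed C) (lp + y) ≡ at q y
      at-q {y} y≤ = trans (at-++ʳ (forget p) (forget q ++ forget r) y) (at-++ˡ (forget q) (forget r) y≤)
      at-r : ∀ z → at (closed C) (lp + (lq + z)) ≡ at r z
      at-r z = trans (at-++ʳ (forget p) (forget q ++ forget r) (lq + z)) (at-++ʳ (forget q) (forget r) z)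
      via : ∀ {x y a b} → at (closed C) x ≡ a → at (closed C) y ≡ b → at (closed C) x ≡ at (closed C) y → a ≡ b
      via ex ey e = trans (sym ex) (trans e ey)
      by-position : ∀ {i j} → Position lp lq lr i → Position lp lq lr j → i < j →
                    at (closed C) i ≡ at (closed C) j → Shorter C
      by-position (in-p i<) (in-p j<) i<j e = loop-in-p p q r i<j (<⇒≤ j<) (via (at-p (<⇒≤ i<)) (at-p (<⇒≤ j<)) e)
      by-position (in-p i<) (in-q y y< refl) _ e = p-meets-q p q r i< y< (via (at-p (<⇒≤ i<)) (at-q (<⇒≤ y<)) e)
      by-position (in-p i<) (in-r z z< refl) _ e = p-meets-r p q r i< z< (via (at-p (<⇒≤ i<)) (at-r z) e)
      by-position (in-q y y< refl) (in-q y′ y′< refl) i<j e =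
        loop-in-q p q r (+-cancelˡ-< lp y y′ i<j) (<⇒≤ y′<) (via (at-q (<⇒≤ y<)) (at-q (<⇒≤ y′<)) e)
      by-position (in-q y y< refl) (in-r z z< refl) _ e = q-meets-r p q r y< z< (via (at-q (<⇒≤ y<)) (at-r z) e)
      by-position (in-r z _ refl) (in-r z′ z′< refl) i<j e =
        loop-in-r p q r (+-cancelˡ-< lq z z′ (+-cancelˡ-< lp (lq + z) (lq + z′) i<j)) (<⇒≤ z′<)
                  (via (at-r z) (at-r z′) e)
      by-position (in-q y _ refl) (in-p j<) i<j _ = ⊥-elim (<⇒≱ (<-trans i<j j<) (m≤m+n lp y))
      by-position (in-r z _ refl) (in-p j<) i<j _ = ⊥-elim (<⇒≱ (<-trans i<j j<) (m≤m+n lp (lq + z)))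
      by-position (in-r z _ refl) (in-q y′ y′< refl) i<j _ =
        ⊥-elim (<⇒≱ (<-trans (+-cancelˡ-< lp (lq + z) y′ i<j) y′<) (m≤m+n lq z))

    Common : Set
    Common = ∃ λ t → Sa t ≡ true × Sb t ≡ true × Sc t ≡ true

    common : (C : WalkTriangle) → Acc _<_ (perimeter C) → Common
    common C@(triangle {t₁} {t₂} {t₃} p q r) (acc smaller) with len p ℕ.≟ 0 | len q ℕ.≟ 0 | len r ℕ.≟ 0
    ... | yes p-empty | _ | _ =
      t₁ , start∈ p , subst (λ t → Sb t ≡ true) (sym (empty⇒≡ p p-empty)) (start∈ q) , end∈ r
    ... | no _ | yes q-empty | _ =
      t₂ , end∈ p , start∈ q , subst (λ t → Sc t ≡ true) (sym (empty⇒≡ q q-empty)) (start∈ r)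
    ... | no _ | no _ | yes r-empty =
      t₃ , subst (λ t → Sa t ≡ true) (sym (empty⇒≡ r r-empty)) (start∈ p) , end∈ q , start∈ r
    ... | no p≢0 | no q≢0 | no r≢0 with collision-or-injective (at (closed C) ∘ toℕ)
    ...   | inj₂ injective = ⊥-elim (forest _ _ (closedWalk⇒cycle (closed C) 3≤L injective))
      where
      3≤L : 3 ≤ perimeter C
      3≤L = +-mono-≤ (n≢0⇒n>0 p≢0) (+-mono-≤ (n≢0⇒n>0 q≢0) (n≢0⇒n>0 r≢0))
    ...   | inj₁ (i , j , i<j , e) with shorten C i<j (FP.toℕ<n j) e
    ...     | C′ , C′<C = common C′ (smaller C′<C)

  helly : Forest T → ∀ {Sa Sb Sc} → ConnectedOn T Sa → ConnectedOn T Sb → ConnectedOn T Sc →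
          ∀ {x y z} → Sa x ≡ true → Sb x ≡ true → Sb y ≡ true → Sc y ≡ true → Sc z ≡ true → Sa z ≡ true →
          ∃ λ t → Sa t ≡ true × Sb t ≡ true × Sc t ≡ true
  helly forest {Sa} {Sb} {Sc} conA conB conC {x} {y} {z} ax bx by cy cz az =
    common (triangle (fromPath (conA z x az ax)) (fromPath (conB x y bx by)) (fromPath (conC y z cy cz))) (<-wellFounded _)
    where open ThreeSubtrees forest Sa Sb Sc

triangle⇒width≥2 : ∀ {n} {G : Graph n} (D : TreeDecomposition G) {a b c} → a ≢ b → a ≢ c → b ≢ c →
                   adj G a b ≡ true → adj G a c ≡ true → adj G b c ≡ true → ∀ w → TDWidth≤ D w → 2 ≤ w
triangle⇒width≥2 D {a} {b} {c} a≢b a≢c b≢c ab ac bc w width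
  with ecover D a b ab | ecover D b c bc | ecover D a c ac
... | _ , a∈ , b∈ | _ , b∈′ , c∈ | _ , a∈′ , c∈′
  with Walks.helly (T D) (proj₂ (proj₂ (isTree D))) (subtree D a) (subtree D b) (subtree D c)
                   a∈ b∈ b∈′ c∈ c∈′ a∈′
... | t , a∈t , b∈t , c∈t = ≤-pred (≤-trans (count-three (bag D t) a≢b a≢c b≢c a∈t b∈t c∈t) (width t))

-- The fan with ears

module Fan (K N : ℕ) where

  data V : Set where
    hub : V
    rim : Fin N → V
    ear : Fin N → Fin K → V

  n : ℕ
  n = suc (N + N * K)

  enc : V → Fin n
  enc hub       = F.zero
  enc (rim j)   = F.suc (j ↑ˡ (N * K))
  enc (ear j i) = F.suc (N ↑ʳ combine j i)

  dec : Fin n → V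
  dec F.zero    = hub
  dec (F.suc x) with splitAt N x
  ... | inj₁ j = rim j
  ... | inj₂ y = ear (proj₁ (remQuot {N} K y)) (proj₂ (remQuot {N} K y))

  dec-enc : ∀ v → dec (enc v) ≡ v
  dec-enc hub       = refl
  dec-enc (rim j)   rewrite FP.splitAt-↑ˡ N j (N * K) = refl
  dec-enc (ear j i) rewrite FP.splitAt-↑ʳ N (N * K) (combine j i) =
    cong₂ ear (cong proj₁ (FP.remQuot-combine {N} {K} j i)) (cong proj₂ (FP.remQuot-combine {N} {K} j i))

  enc-dec : ∀ x → enc (dec x) ≡ x
  enc-dec F.zero    = refl
  enc-dec (F.suc x) with splitAt N x in eq
  ... | inj₁ j = cong F.suc (FP.splitAt⁻¹-↑ˡ eq)
  ... | inj₂ y = cong F.suc (trans (cong (N ↑ʳ_) (FP.combine-remQuot {N} K y)) (FP.splitAt⁻¹-↑ʳ eq))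

  dec-injective : ∀ {x y} → dec x ≡ dec y → x ≡ y
  dec-injective {x} {y} e = trans (sym (enc-dec x)) (trans (cong enc e) (enc-dec y))

  enc-injective : ∀ {u v} → enc u ≡ enc v → u ≡ v
  enc-injective {u} {v} e = trans (sym (dec-enc u)) (trans (cong dec e) (dec-enc v))

  _⋖_ : Fin N → Fin N → Set
  a ⋖ b = suc (toℕ a) ≡ toℕ b

  _⋖?_ : ∀ a b → Dec (a ⋖ b)
  a ⋖? b = suc (toℕ a) ℕ.≟ toℕ b

  ⋖-functional : ∀ {a b b′} → a ⋖ b → a ⋖ b′ → b ≡ b′
  ⋖-functional a⋖b a⋖b′ = FP.toℕ-injective (trans (sym a⋖b) a⋖b′)

  ⋖-injective : ∀ {a a′ b} → a ⋖ b → a′ ⋖ b → a ≡ a′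
  ⋖-injective a⋖b a′⋖b = FP.toℕ-injective (suc-injective (trans a⋖b (sym a′⋖b)))

  -- The edges of the fan, each oriented towards its end of larger rank.  The ears of the last rim vertex
  -- have no second rim neighbour.
  _↗_ : V → V → Set
  ear j _ ↗ rim b = j ≡ b ⊎ j ⋖ b
  rim a   ↗ rim b = a ⋖ b
  rim _   ↗ hub   = ⊤
  _       ↗ _     = ⊥

  _↗?_ : ∀ u v → Dec (u ↗ v)
  hub     ↗? _       = no λ ()
  rim a   ↗? hub     = yes tt
  rim a   ↗? rim b   = a ⋖? b
  rim _   ↗? ear _ _ = no λ ()
  ear _ _ ↗? hub     = no λ ()
  ear j _ ↗? rim b   = (j F.≟ b) ⊎-dec (j ⋖? b)
  ear _ _ ↗? ear _ _ = no λ ()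

  rank : V → ℕ
  rank hub       = suc N
  rank (rim a)   = suc (toℕ a)
  rank (ear _ _) = 0

  ↗-rank : ∀ {u v} → u ↗ v → rank u < rank v
  ↗-rank {ear _ _} {rim _} _   = s≤s z≤n
  ↗-rank {rim _}   {rim _} a⋖b = s≤s (≤-reflexive a⋖b)
  ↗-rank {rim a}   {hub}   _   = s≤s (FP.toℕ<n a)

  module Oriented (_⇒_ : V → V → Set) (_⇒?_ : ∀ u v → Dec (u ⇒ v))
                  (⇒-rank : ∀ {u v} → u ⇒ v → rank u < rank v) where

    _~_ : V → V → Set
    u ~ v = u ⇒ v ⊎ v ⇒ u

    _~?_ : ∀ u v → Dec (u ~ v)
    u ~? v = (u ⇒? v) ⊎-dec (v ⇒? u)

    ~-rank : ∀ {u v} → u ~ v → rank u ≢ rank v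
    ~-rank (inj₁ u⇒v) = <⇒≢ (⇒-rank u⇒v)
    ~-rank (inj₂ v⇒u) = >⇒≢ (⇒-rank v⇒u)

    ~-upward : ∀ {u v} → u ~ v → rank u < rank v → u ⇒ v
    ~-upward (inj₁ u⇒v) _   = u⇒v
    ~-upward (inj₂ v⇒u) u<v = ⊥-elim (<-asym u<v (⇒-rank v⇒u))

    graph : Graph n
    graph = record
      { adj    = λ x y → does (dec x ~? dec y)
      ; sym    = λ x y → ∨-comm (does (dec x ⇒? dec y)) (does (dec y ⇒? dec x))
      ; irrefl = λ x → dec-false (dec x ~? dec x) (λ x~x → ~-rank x~x refl) }

    adj-enc : ∀ {u v} → u ~ v → adj graph (enc u) (enc v) ≡ true
    adj-enc {u} {v} u~v = dec-true (dec (enc u) ~? dec (enc v)) (subst₂ _~_ (sym (dec-enc u)) (sym (dec-enc v)) u~v)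

    adj-dec : ∀ {x y} → adj graph x y ≡ true → dec x ~ dec y
    adj-dec {x} {y} = fromDoes {a? = dec x ~? dec y}

    open RankCriteria graph (rank ∘ dec) (λ {x} {y} → ~-rank ∘ adj-dec {x} {y}) public

    above-dec : ∀ {x y} → Above x y → dec x ⇒ dec y
    above-dec {x} {y} (x~y , x<y) = ~-upward (adj-dec {x} {y} x~y) x<y

  open Oriented _↗_ _↗?_ ↗-rank public renaming (graph to fan)

  ↗-clique : ∀ {v u w} → v ↗ u → v ↗ w → u ≢ w → u ~ w
  ↗-clique {ear _ _} {rim _} {rim _} (inj₁ refl) (inj₁ refl) b≢b′ = ⊥-elim (b≢b′ refl)
  ↗-clique {ear _ _} {rim _} {rim _} (inj₁ refl) (inj₂ j⋖b′) _    = inj₁ j⋖b′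
  ↗-clique {ear _ _} {rim _} {rim _} (inj₂ j⋖b)  (inj₁ refl) _    = inj₂ j⋖b
  ↗-clique {ear _ _} {rim _} {rim _} (inj₂ j⋖b)  (inj₂ j⋖b′) b≢b′ =
    ⊥-elim (b≢b′ (cong rim (⋖-functional j⋖b j⋖b′)))
  ↗-clique {rim _}   {rim _} {rim _} a⋖b a⋖b′ b≢b′ = ⊥-elim (b≢b′ (cong rim (⋖-functional a⋖b a⋖b′)))
  ↗-clique {rim _}   {rim _} {hub}   _ _ _ = inj₁ tt
  ↗-clique {rim _}   {hub}   {rim _} _ _ _ = inj₂ tt
  ↗-clique {rim _}   {hub}   {hub}   _ _ hub≢hub = ⊥-elim (hub≢hub refl)

  fan-chordal : Chordal fan
  fan-chordal = perfectElimination⇒chordal λ {v} {u} {w} v<u v<w u≢w →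
    dec-true (dec u ~? dec w) (↗-clique (above-dec {v} {u} v<u) (above-dec {v} {w} v<w) (u≢w ∘ dec-injective))

  countV : (V → Bool) → ℕ
  countV P = χ (P hub) + (count (P ∘ rim) + sum (λ j → count (P ∘ ear j)))

  count-dec : ∀ (P : V → Bool) → count (P ∘ dec) ≡ countV P
  count-dec P = trans (count≡sum-χ (P ∘ dec))
                      (cong (χ (P hub) +_) (trans (sum-↑ {N} {N * K} _) (cong₂ _+_ rims ears)))
    where
    rims : sum (λ j → χ (P (dec (enc (rim j))))) ≡ count (P ∘ rim)
    rims = trans (sum-cong λ j → cong (χ ∘ P) (dec-enc (rim j))) (sym (count≡sum-χ (P ∘ rim)))
    ears : sum (λ x → χ (P (dec (F.suc (N ↑ʳ x))))) ≡ sum (λ j → count (P ∘ ear j))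
    ears = trans (sum-combine {N} {K} _)
                 (sum-cong λ j → trans (sum-cong λ i → cong (χ ∘ P) (dec-enc (ear j i)))
                                       (sym (count≡sum-χ (P ∘ ear j))))

  no-ears : sum {N} (λ _ → count {K} (λ _ → false)) ≡ 0
  no-ears = trans (sum-cong {N} λ _ → count-none {K} λ _ → refl) (trans (sum-const {N} 0) (*-zeroʳ N))

  count-≡-or-⋖ : ∀ j → count (λ b → does ((j F.≟ b) ⊎-dec (j ⋖? b))) ≤ 2
  count-≡-or-⋖ j = ≤-trans (count-∨ (λ b → does (j F.≟ b)) (λ b → does (j ⋖? b)))
                           (+-mono-≤ (count-unique (j F.≟_) (λ e e′ → trans (sym e) e′))
                                     (count-unique (j ⋖?_) ⋖-functional))

  count-above : ∀ u → countV (λ v → does (u ↗? v)) ≤ 2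
  count-above hub       = ≤-trans (≤-reflexive (cong₂ _+_ (count-none {N} λ _ → refl) no-ears)) z≤n
  count-above (rim a)   = s≤s (≤-trans (+-mono-≤ (count-unique (a ⋖?_) ⋖-functional) (≤-reflexive no-ears))
                                       (s≤s z≤n))
  count-above (ear j _) = ≤-trans (+-mono-≤ (count-≡-or-⋖ j) (≤-reflexive no-ears)) (≤-reflexive (+-identityʳ 2))

  neighbours : V → V → Bool
  neighbours u v = does (u ~? v)

  degree-dec : ∀ x → degree fan x ≡ countV (neighbours (dec x))
  degree-dec x = count-dec (neighbours (dec x))

  degree-hub : countV (neighbours hub) ≡ N
  degree-hub = trans (cong₂ _+_ (trans (count-const {N} true) (*-identityʳ N)) no-ears) (+-identityʳ N)

  degree-ear : ∀ j i → countV (neighbours (ear j i)) ≤ 2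
  degree-ear j i = ≤-trans (+-mono-≤ rims (≤-reflexive no-ears)) (≤-reflexive (+-identityʳ 2))
    where
    rims : count (λ b → does ((j F.≟ b) ⊎-dec (j ⋖? b)) ∨ false) ≤ 2
    rims = ≤-trans (≤-reflexive (count-cong {N} λ b → ∨-identityʳ (does ((j F.≟ b) ⊎-dec (j ⋖? b)))))
                   (count-≡-or-⋖ j)

  degree-rim : ∀ a → countV (neighbours (rim a)) ≤ 3 + 2 * K
  degree-rim a = s≤s (+-mono-≤ rims ears)
    where
    rims : count (λ b → does (a ⋖? b) ∨ does (b ⋖? a)) ≤ 2
    rims = ≤-trans (count-∨ (λ b → does (a ⋖? b)) (λ b → does (b ⋖? a)))
                   (+-mono-≤ (count-unique (a ⋖?_) ⋖-functional) (count-unique (_⋖? a) ⋖-injective))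
    attached : Fin N → Bool
    attached j = does ((j F.≟ a) ⊎-dec (j ⋖? a))
    attached≤2 : count attached ≤ 2
    attached≤2 = ≤-trans (count-∨ (λ j → does (j F.≟ a)) (λ j → does (j ⋖? a)))
                         (+-mono-≤ (≤-reflexive (count-≟ a)) (count-unique (_⋖? a) ⋖-injective))
    ears : sum (λ j → count {K} (λ _ → attached j)) ≤ 2 * K
    ears = begin
      sum (λ j → count {K} (λ _ → attached j)) ≡⟨ sum-cong (λ j → count-const {K} (attached j)) ⟩
      sum (λ j → K * χ (attached j))           ≡⟨ sum-*ˡ K (χ ∘ attached) ⟩
      K * sum (χ ∘ attached)                   ≡⟨ cong (K *_) (sym (count≡sum-χ attached)) ⟩
      K * count attached                       ≤⟨ *-monoʳ-≤ K attached≤2 ⟩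
      K * 2                                    ≡⟨ *-comm K 2 ⟩
      2 * K                                    ∎
      where open ≤-Reasoning

  fan-maxDegree : 3 + 2 * K ≤ N → MaxDegree fan N
  fan-maxDegree 3+2K≤N = (λ x → subst (_≤ N) (sym (degree-dec x)) (bound (dec x))) ,
                         F.zero , trans (degree-dec F.zero) degree-hub
    where
    bound : ∀ u → countV (neighbours u) ≤ N
    bound hub       = ≤-reflexive degree-hub
    bound (rim a)   = ≤-trans (degree-rim a) 3+2K≤N
    bound (ear j i) = ≤-trans (degree-ear j i) (≤-trans (s≤s (s≤s z≤n)) (≤-trans (m≤m+n 3 (2 * K)) 3+2K≤N))

  -- Parent in the decomposition tree: ear j i ⇀ rim j ⇀ rim (j + 1) ⇀ … ⇀ hub.
  _⇀_ : V → V → Set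
  ear j _ ⇀ rim b = j ≡ b
  rim a   ⇀ rim b = a ⋖ b
  rim a   ⇀ hub   = suc (toℕ a) ≡ N
  _       ⇀ _     = ⊥

  _⇀?_ : ∀ u v → Dec (u ⇀ v)
  hub     ⇀? _       = no λ ()
  rim a   ⇀? hub     = suc (toℕ a) ℕ.≟ N
  rim a   ⇀? rim b   = a ⋖? b
  rim _   ⇀? ear _ _ = no λ ()
  ear _ _ ⇀? hub     = no λ ()
  ear j _ ⇀? rim b   = j F.≟ b
  ear _ _ ⇀? ear _ _ = no λ ()

  ⇀⇒↗ : ∀ {u v} → u ⇀ v → u ↗ v
  ⇀⇒↗ {ear _ _} {rim _} j≡b = inj₁ j≡b
  ⇀⇒↗ {rim _}   {rim _} a⋖b = a⋖b
  ⇀⇒↗ {rim _}   {hub}   _   = tt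

  ⇀-functional : ∀ {u v v′} → u ⇀ v → u ⇀ v′ → v ≡ v′
  ⇀-functional {ear _ _} {rim _} {rim _} refl refl = refl
  ⇀-functional {rim _}   {rim _} {rim _} a⋖b a⋖b′ = cong rim (⋖-functional a⋖b a⋖b′)
  ⇀-functional {rim _}   {rim b} {hub}   a⋖b last = ⊥-elim (<-irrefl (trans (sym a⋖b) last) (FP.toℕ<n b))
  ⇀-functional {rim _}   {hub}   {rim b} last a⋖b = ⊥-elim (<-irrefl (trans (sym a⋖b) last) (FP.toℕ<n b))
  ⇀-functional {rim _}   {hub}   {hub}   _ _ = refl

  module Spine = Oriented _⇀_ _⇀?_ (↗-rank ∘ ⇀⇒↗)
  open Spine using () renaming (graph to spine)

  spine-forest : Forest spine
  spine-forest = Spine.uniqueAbove⇒forest λ {v} {u} {w} v<u v<w →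
    dec-injective (⇀-functional (Spine.above-dec {v} {u} v<u) (Spine.above-dec {v} {w} v<w))

  climb : ∀ {S : Fin n → Bool} → (∀ b → S (enc (rim b)) ≡ true) → S (enc hub) ≡ true →
          ∀ a → PathIn spine S (enc (rim a)) (enc hub)
  climb {S} rims∈ hub∈ a = go (N ∸ suc (toℕ a)) a (m+[n∸m]≡n (FP.toℕ<n a))
    where
    go : ∀ d a → suc (toℕ a) + d ≡ N → PathIn spine S (enc (rim a)) (enc hub)
    go zero    a last =
      step (rims∈ a) (Spine.adj-enc {rim a} {hub} (inj₁ (trans (sym (+-identityʳ _)) last))) (here hub∈)
    go (suc d) a e    = step (rims∈ a) (Spine.adj-enc {rim a} {rim b} (inj₁ (sym (FP.toℕ-fromℕ< a+1<N))))
                             (go d b (trans (cong (λ x → suc x + d) (FP.toℕ-fromℕ< a+1<N)) e′))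
      where
      e′ : suc (suc (toℕ a) + d) ≡ N
      e′ = trans (sym (+-suc (suc (toℕ a)) d)) e
      a+1<N : suc (toℕ a) < N
      a+1<N = subst (suc (suc (toℕ a)) ≤_) e′ (s≤s (m≤m+n (suc (toℕ a)) d))
      b : Fin N
      b = fromℕ< a+1<N

  spine-tree : Tree spine
  spine-tree = s≤s z≤n ,
               connectedVia (enc hub) (λ t _ → subst (λ x → PathIn spine _ x (enc hub)) (enc-dec t) (toHub (dec t))) ,
               spine-forest
    where
    toHub : ∀ u → PathIn spine (λ _ → true) (enc u) (enc hub)
    toHub hub       = here refl
    toHub (rim a)   = climb (λ _ → refl) refl a
    toHub (ear j i) = step refl (Spine.adj-enc {ear j i} {rim j} (inj₁ refl)) (climb (λ _ → refl) refl j)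

  fanBag : Fin n → Fin n → Bool
  fanBag t x = does (x F.≟ t) ∨ does (dec t ↗? dec x)

  bag-self : ∀ x → fanBag x x ≡ true
  bag-self x = cong (_∨ does (dec x ↗? dec x)) (dec-true (x F.≟ x) refl)

  bag-↗ : ∀ {t x} → dec t ↗ dec x → fanBag t x ≡ true
  bag-↗ {t} {x} t↗x = trans (cong (does (x F.≟ t) ∨_) (dec-true (dec t ↗? dec x) t↗x)) (∨-zeroʳ _)

  bag-enc : ∀ {u v} → u ↗ v → fanBag (enc u) (enc v) ≡ true
  bag-enc {u} {v} u↗v = bag-↗ {enc u} {enc v} (subst₂ _↗_ (sym (dec-enc u)) (sym (dec-enc v)) u↗v)

  bag-width : ∀ t → count (fanBag t) ≤ 3
  bag-width t = ≤-trans (count-∨ (λ x → does (x F.≟ t)) (λ x → does (dec t ↗? dec x)))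
                        (+-mono-≤ (≤-reflexive (count-≟ t))
                                  (subst (_≤ 2) (sym (count-dec (λ v → does (dec t ↗? v)))) (count-above (dec t))))

  bag-connected : ∀ x → ConnectedOn spine (λ t → fanBag t x)
  bag-connected x = connectedVia x toX
    where
    descend : ∀ u v → u ↗ v → PathIn spine (λ t → fanBag t (enc v)) (enc u) (enc v)
    descend (ear j i) (rim b) (inj₁ refl) =
      step (bag-enc {ear j i} {rim j} (inj₁ refl)) (Spine.adj-enc {ear j i} {rim j} (inj₁ refl))
           (here (bag-self (enc (rim j))))
    descend (ear j i) (rim b) (inj₂ j⋖b) =
      step (bag-enc {ear j i} {rim b} (inj₂ j⋖b)) (Spine.adj-enc {ear j i} {rim j} (inj₁ refl))
           (step (bag-enc {rim j} {rim b} j⋖b) (Spine.adj-enc {rim j} {rim b} (inj₁ j⋖b)) (here (bag-self (enc (rim b)))))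
    descend (rim a) (rim b) a⋖b =
      step (bag-enc {rim a} {rim b} a⋖b) (Spine.adj-enc {rim a} {rim b} (inj₁ a⋖b)) (here (bag-self (enc (rim b))))
    descend (rim a) hub     _   = climb (λ b → bag-enc {rim b} {hub} tt) (bag-self (enc hub)) a
    toX : ∀ t → fanBag t x ≡ true → PathIn spine (λ t → fanBag t x) t x
    toX t t∈ with x F.≟ t
    ... | yes refl = here (bag-self x)
    ... | no  _    = subst₂ (λ t′ x′ → PathIn spine (λ s → fanBag s x′) t′ x′) (enc-dec t) (enc-dec x)
                            (descend (dec t) (dec x) (fromDoes {a? = dec t ↗? dec x} t∈))

  decomposition : TreeDecomposition fan
  decomposition = record
    { m = n ; T = spine ; isTree = spine-tree ; bag = fanBag
    ; vcover = λ v → v , bag-self v ; ecover = edge-covered ; subtree = bag-connected }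
    where
    edge-covered : ∀ u v → adj fan u v ≡ true → ∃ λ t → fanBag t u ≡ true × fanBag t v ≡ true
    edge-covered u v u~v with adj-dec {u} {v} u~v
    ... | inj₁ u↗v = u , bag-self u , bag-↗ {u} {v} u↗v
    ... | inj₂ v↗u = v , bag-↗ {v} {u} v↗u , bag-self v

  fan-treewidth : 2 ≤ N → HasTreewidth fan 2
  fan-treewidth 2≤N = (decomposition , bag-width) ,
    λ D → triangle⇒width≥2 D {enc hub} {enc (rim r₀)} {enc (rim r₁)} (λ ()) (λ ()) r₀≢r₁
                           (adj-enc {hub} {rim r₀} (inj₂ tt)) (adj-enc {hub} {rim r₁} (inj₂ tt))
                     (adj-enc {rim r₀} {rim r₁} (inj₁ r₀⋖r₁))
    where
    0<N : 0 < N
    0<N = ≤-trans (s≤s z≤n) 2≤N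
    r₀ r₁ : Fin N
    r₀ = fromℕ< 0<N
    r₁ = fromℕ< 2≤N
    r₀⋖r₁ : r₀ ⋖ r₁
    r₀⋖r₁ = trans (cong suc (FP.toℕ-fromℕ< 0<N)) (sym (FP.toℕ-fromℕ< 2≤N))
    r₀≢r₁ : enc (rim r₀) ≢ enc (rim r₁)
    r₀≢r₁ e = 1+n≢n (trans r₀⋖r₁ (cong toℕ (sym (rim-injective (enc-injective e)))))
      where
      rim-injective : ∀ {a b} → rim a ≡ rim b → a ≡ b
      rim-injective refl = refl

  rim-next : ∀ {j} (j<N : j < N) (j+1<N : suc j < N) → rim (fromℕ< j<N) ↗ rim (fromℕ< j+1<N)
  rim-next j<N j+1<N = trans (cong suc (FP.toℕ-fromℕ< j<N)) (sym (FP.toℕ-fromℕ< j+1<N))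

-- Sums over segments of ℕ

sumFrom : (ℕ → ℕ) → ℕ → ℕ → ℕ
sumFrom f p zero    = 0
sumFrom f p (suc d) = f p + sumFrom f (suc p) d

sum-toℕ : ∀ {n} (f : ℕ → ℕ) → sum {n} (f ∘ toℕ) ≡ sumFrom f 0 n
sum-toℕ {n} f = go n 0
  where
  go : ∀ n p → sum {n} (λ i → f (p + toℕ i)) ≡ sumFrom f p n
  go zero    p = refl
  go (suc n) p = cong₂ _+_ (cong f (+-identityʳ p))
                           (trans (sum-cong {n} λ i → cong f (+-suc p (toℕ i))) (go n (suc p)))

sumFrom-++ : ∀ f p d e → sumFrom f p (d + e) ≡ sumFrom f p d + sumFrom f (p + d) e
sumFrom-++ f p zero    e = cong (λ q → sumFrom f q e) (sym (+-identityʳ p))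
sumFrom-++ f p (suc d) e = trans (cong (f p +_) (trans (sumFrom-++ f (suc p) d e)
                                                        (cong (λ q → sumFrom f (suc p) d + sumFrom f q e) (sym (+-suc p d)))))
                                 (sym (+-assoc (f p) _ _))

sumFrom-mono-≤ : ∀ {f g} p d → (∀ j → p ≤ j → j < p + d → f j ≤ g j) → sumFrom f p d ≤ sumFrom g p d
sumFrom-mono-≤ p zero    f≤g = z≤n
sumFrom-mono-≤ p (suc d) f≤g =
  +-mono-≤ (f≤g p ≤-refl (m<m+n p (s≤s z≤n)))
           (sumFrom-mono-≤ (suc p) d λ j p<j j< → f≤g j (<⇒≤ p<j) (subst (j <_) (sym (+-suc p d)) j<))

sumFrom-cong : ∀ {f g} p d → (∀ j → f j ≡ g j) → sumFrom f p d ≡ sumFrom g p d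
sumFrom-cong p zero    f≗g = refl
sumFrom-cong p (suc d) f≗g = cong₂ _+_ (f≗g p) (sumFrom-cong (suc p) d f≗g)

sumFrom-+ : ∀ f g p d → sumFrom (λ j → f j + g j) p d ≡ sumFrom f p d + sumFrom g p d
sumFrom-+ f g p zero    = refl
sumFrom-+ f g p (suc d) = trans (cong (f p + g p +_) (sumFrom-+ f g (suc p) d)) (+-interchange (f p) (g p) _ _)

sumFrom-*ˡ : ∀ c f p d → sumFrom (λ j → c * f j) p d ≡ c * sumFrom f p d
sumFrom-*ˡ c f p zero    = sym (*-zeroʳ c)
sumFrom-*ˡ c f p (suc d) = trans (cong (c * f p +_) (sumFrom-*ˡ c f (suc p) d)) (sym (*-distribˡ-+ c (f p) _))

sumFrom-const : ∀ c p d → sumFrom (λ _ → c) p d ≡ d * c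
sumFrom-const c p zero    = refl
sumFrom-const c p (suc d) = cong (c +_) (sumFrom-const c (suc p) d)

term≤sumFrom : ∀ f {p d j} → p ≤ j → j < p + d → f j ≤ sumFrom f p d
term≤sumFrom f {p} {zero} {j} p≤j j< = ⊥-elim (<⇒≱ j< (subst (_≤ j) (sym (+-identityʳ p)) p≤j))
term≤sumFrom f {p} {suc d} {j} p≤j j< with m≤n⇒m<n∨m≡n p≤j
... | inj₂ refl = m≤m+n (f p) _
... | inj₁ p<j  = ≤-trans (term≤sumFrom f p<j (subst (j <_) (+-suc p d) j<)) (m≤n+m _ (f p))

two-terms≤sumFrom : ∀ f {p d j k} → p ≤ j → j < k → k < p + d → f j + f k ≤ sumFrom f p d
two-terms≤sumFrom f {p} {zero} {j} p≤j j<k k< =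
  ⊥-elim (<⇒≱ (<-trans j<k k<) (subst (_≤ j) (sym (+-identityʳ p)) p≤j))
two-terms≤sumFrom f {p} {suc d} {j} {k} p≤j j<k k< with m≤n⇒m<n∨m≡n p≤j
... | inj₂ refl = +-monoʳ-≤ (f p) (term≤sumFrom f j<k (subst (k <_) (+-suc p d) k<))
... | inj₁ p<j  = ≤-trans (two-terms≤sumFrom f p<j j<k (subst (k <_) (+-suc p d) k<)) (m≤n+m _ (f p))

sumFrom-inside : ∀ f {p d} n → p + d ≤ n → sumFrom f p d ≤ sumFrom f 0 n
sumFrom-inside f {p} {d} n p+d≤n = begin
  sumFrom f p d                                                  ≤⟨ m≤n+m _ (sumFrom f 0 p) ⟩
  sumFrom f 0 p + sumFrom f p d                                  ≡⟨ sym (sumFrom-++ f 0 p d) ⟩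
  sumFrom f 0 (p + d)                                            ≤⟨ m≤m+n _ _ ⟩
  sumFrom f 0 (p + d) + sumFrom f (p + d) (n ∸ (p + d))         ≡⟨ sym (sumFrom-++ f 0 (p + d) (n ∸ (p + d))) ⟩
  sumFrom f 0 (p + d + (n ∸ (p + d)))                            ≡⟨ cong (sumFrom f 0) (m+[n∸m]≡n p+d≤n) ⟩
  sumFrom f 0 n                                                  ∎
  where open ≤-Reasoning

sumFrom-χ-unique : ∀ {P : ℕ → Set} (P? : ∀ p → Dec (P p)) → (∀ {i j} → P i → P j → i ≡ j) →
                   ∀ n → sumFrom (λ p → χ (does (P? p))) 0 n ≤ 1
sumFrom-χ-unique P? unique n = begin
  sumFrom (χ ∘ does ∘ P?) 0 n       ≡⟨ sym (sum-toℕ {n} (χ ∘ does ∘ P?)) ⟩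
  sum {n} (χ ∘ does ∘ P? ∘ toℕ)     ≡⟨ sym (count≡sum-χ {n} (does ∘ P? ∘ toℕ)) ⟩
  count {n} (does ∘ P? ∘ toℕ)       ≤⟨ count-unique {n} (P? ∘ toℕ) (λ Pi Pj → FP.toℕ-injective (unique Pi Pj)) ⟩
  1                                 ∎
  where open ≤-Reasoning

module Segments (N : ℕ) (marked : ℕ → Bool) where

  record Segment (p d : ℕ) : Set where
    field
      nonempty : 1 ≤ d
      inside   : p + d ≤ N
      start    : p ≡ 0 ⊎ marked p ≡ true
      unmarked : ∀ j → p < j → j < p + d → marked j ≡ false
      end      : p + d ≡ N ⊎ marked (p + d) ≡ true

  record NextMark (p rest : ℕ) : Set where
    field
      distance  : ℕ
      positive  : 1 ≤ distance
      within    : distance ≤ rest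
      unmarked  : ∀ j → p < j → j < p + distance → marked j ≡ false
      reached   : p + distance ≡ N ⊎ marked (p + distance) ≡ true

  marked-end : ∀ {p d} → Segment p d → p + d < N → marked (p + d) ≡ true
  marked-end S p+d<N with Segment.end S
  ... | inj₁ p+d≡N = ⊥-elim (<-irrefl p+d≡N p+d<N)
  ... | inj₂ isMarked = isMarked

  nothing-between : ∀ {p} j → p < j → j < p + 1 → marked j ≡ false
  nothing-between {p} j p<j j<p+1 = ⊥-elim (<⇒≱ j<p+1 (subst (_≤ j) (+-comm 1 p) p<j))

  extendLeft : ∀ {p rest} → marked (suc p) ≡ false → NextMark (suc p) rest → NextMark p (suc rest)
  extendLeft {p} unmarked-p+1 M = record
    { distance = suc distance ; positive = s≤s z≤n ; within = s≤s within
    ; unmarked = unmarked′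
    ; reached = subst (λ q → q ≡ N ⊎ marked q ≡ true) (sym (+-suc p distance)) reached }
    where
    open NextMark M
    unmarked′ : ∀ j → p < j → j < p + suc distance → marked j ≡ false
    unmarked′ j p<j j< with m≤n⇒m<n∨m≡n p<j
    ... | inj₂ refl  = unmarked-p+1
    ... | inj₁ p+1<j = unmarked j p+1<j (subst (j <_) (+-suc p distance) j<)

  nextMark : ∀ p rest → p + rest ≡ N → 1 ≤ rest → NextMark p rest
  nextMark p zero _ ()
  nextMark p (suc rest) p+rest≡N _ = lookAt (marked (suc p)) refl (rest ℕ.≟ 0)
    where
    lookAt : ∀ b → marked (suc p) ≡ b → Dec (rest ≡ 0) → NextMark p (suc rest)
    lookAt true marked-p+1 _ = record
      { distance = 1 ; positive = ≤-refl ; within = s≤s z≤n ; unmarked = nothing-between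
      ; reached = inj₂ (subst (λ q → marked q ≡ true) (+-comm 1 p) marked-p+1) }
    lookAt false _ (yes rest≡0) = record
      { distance = 1 ; positive = ≤-refl ; within = s≤s z≤n ; unmarked = nothing-between
      ; reached = inj₁ (trans (cong (λ r → p + suc r) (sym rest≡0)) p+rest≡N) }
    lookAt false unmarked-p+1 (no rest≢0) =
      extendLeft unmarked-p+1 (nextMark (suc p) rest (trans (sym (+-suc p rest)) p+rest≡N) (n≢0⇒n>0 rest≢0))

  module _ (f g : ℕ → ℕ) (segment : ∀ {p d} → Segment p d → sumFrom f p d ≤ sumFrom g p d) where

    private
      fromStart : ∀ p rest → p + rest ≡ N → (p ≡ 0 ⊎ marked p ≡ true) → Acc _<_ rest →
                  sumFrom f p rest ≤ sumFrom g p rest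
      fromStart p zero    _ _ _ = z≤n
      fromStart p (suc r) p+rest≡N p-start (acc smaller) = begin
        sumFrom f p (suc r)                             ≡⟨ split-at-next f ⟩
        sumFrom f p distance + sumFrom f (p + distance) rest′ ≤⟨ +-mono-≤ (segment S) (continue reached) ⟩
        sumFrom g p distance + sumFrom g (p + distance) rest′ ≡⟨ sym (split-at-next g) ⟩
        sumFrom g p (suc r)                             ∎
        where
        open NextMark (nextMark p (suc r) p+rest≡N (s≤s z≤n))
        open ≤-Reasoning
        rest′ : ℕ
        rest′ = suc r ∸ distance
        p+d+rest′≡N : p + distance + rest′ ≡ N
        p+d+rest′≡N = trans (+-assoc p distance rest′) (trans (cong (p +_) (m+[n∸m]≡n within)) p+rest≡N)
        split-at-next : ∀ h → sumFrom h p (suc r) ≡ sumFrom h p distance + sumFrom h (p + distance) rest′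
        split-at-next h = trans (cong (sumFrom h p) (sym (m+[n∸m]≡n within))) (sumFrom-++ h p distance rest′)
        S : Segment p distance
        S = record
          { nonempty = positive ; inside = ≤-trans (+-monoʳ-≤ p within) (≤-reflexive p+rest≡N)
          ; start = p-start ; unmarked = unmarked ; end = reached }
        continue : p + distance ≡ N ⊎ marked (p + distance) ≡ true →
                   sumFrom f (p + distance) rest′ ≤ sumFrom g (p + distance) rest′
        continue (inj₁ p+d≡N) =
          subst (λ k → sumFrom f (p + distance) k ≤ sumFrom g (p + distance) k) (sym rest′≡0) z≤n
          where
          rest′≡0 : rest′ ≡ 0
          rest′≡0 = +-cancelˡ-≡ (p + distance) rest′ 0
                      (trans p+d+rest′≡N (trans (sym p+d≡N) (sym (+-identityʳ _))))
        continue (inj₂ marked-p+d) = fromStart (p + distance) rest′ p+d+rest′≡N (inj₂ marked-p+d)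
                                        (smaller (∸-monoʳ-< positive within))

    segment-sum : sumFrom f 0 N ≤ sumFrom g 0 N
    segment-sum = fromStart 0 N refl (inj₁ refl) (<-wellFounded N)

-- Tree-partitions of the fan

trade-boundaries : ∀ K W {x y b e c} → x + K * b ≤ c + y → 3 * c ≤ 3 + 4 * K →
                   3 + 4 * K ≤ 3 * (K * b) + W * e → 3 * x ≤ 3 * y + W * e
trade-boundaries K W {x} {y} {b} {e} {c} x+Kb≤c+y 3c≤ enough =
  +-cancelˡ-≤ (3 * (K * b)) (3 * x) (3 * y + W * e) (begin
  3 * (K * b) + 3 * x           ≡⟨ lemma₁ K x b ⟩
  3 * (x + K * b)               ≤⟨ *-monoʳ-≤ 3 x+Kb≤c+y ⟩
  3 * (c + y)                   ≡⟨ *-distribˡ-+ 3 c y ⟩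
  3 * c + 3 * y                 ≤⟨ +-monoˡ-≤ (3 * y) (≤-trans 3c≤ enough) ⟩
  3 * (K * b) + W * e + 3 * y   ≡⟨ lemma₂ (3 * (K * b)) (W * e) (3 * y) ⟩
  3 * (K * b) + (3 * y + W * e) ∎)
  where
  open ≤-Reasoning
  lemma₁ : ∀ K x b → 3 * (K * b) + 3 * x ≡ 3 * (x + K * b)
  lemma₁ = solve-∀
  lemma₂ : ∀ a b c → a + b + c ≡ a + (c + b)
  lemma₂ = solve-∀

two-boundaries : ∀ {K} W {b} e → 2 ≤ K → 2 ≤ b → 3 + 4 * K ≤ 3 * (K * b) + W * e
two-boundaries {K} W {b} e 2≤K 2≤b = begin
  3 + 4 * K         ≤⟨ +-monoˡ-≤ (4 * K) (≤-trans (s≤s (s≤s (s≤s z≤n))) (*-monoʳ-≤ 2 2≤K)) ⟩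
  2 * K + 4 * K     ≡⟨ lemma K ⟩
  3 * (K * 2)       ≤⟨ *-monoʳ-≤ 3 (*-monoʳ-≤ K 2≤b) ⟩
  3 * (K * b)       ≤⟨ m≤m+n _ (W * e) ⟩
  3 * (K * b) + W * e ∎
  where
  open ≤-Reasoning
  lemma : ∀ K → 2 * K + 4 * K ≡ 3 * (K * 2)
  lemma = solve-∀

boundary-and-end : ∀ K {b e} → 1 ≤ b → 1 ≤ e → 3 + 4 * K ≤ 3 * (K * b) + (K + 3) * e
boundary-and-end K {b} {e} 1≤b 1≤e = begin
  3 + 4 * K                      ≡⟨ lemma K ⟩
  3 * (K * 1) + (K + 3) * 1      ≤⟨ +-mono-≤ (*-monoʳ-≤ 3 (*-monoʳ-≤ K 1≤b)) (*-monoʳ-≤ (K + 3) 1≤e) ⟩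
  3 * (K * b) + (K + 3) * e      ∎
  where
  open ≤-Reasoning
  lemma : ∀ K → 3 + 4 * K ≡ 3 * (K * 1) + (K + 3) * 1
  lemma = solve-∀

rim-too-long : ∀ K {SA Sn Sα E bA} → SA + Sn ≡ 3 + 2 * K → 3 * Sn ≤ 3 * Sα + (K + 3) * E → E ≤ 2 →
               1 + (SA + Sα) ≤ bA → 3 * bA ≤ 3 + 4 * K → ⊥
rim-too-long K {SA} {Sn} {Sα} {E} {bA} SA+Sn≡N 3Sn≤ E≤2 1+SA+Sα≤bA 3bA≤ =
  <⇒≱ (+-monoˡ-< (6 * K) (m<m+n 6 {3} (s≤s z≤n))) (begin
  9 + 6 * K                          ≡⟨ lemma₁ K ⟩
  3 * (3 + 2 * K)                    ≡⟨ cong (3 *_) (sym SA+Sn≡N) ⟩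
  3 * (SA + Sn)                      ≡⟨ *-distribˡ-+ 3 SA Sn ⟩
  3 * SA + 3 * Sn                    ≤⟨ +-monoʳ-≤ (3 * SA) (≤-trans 3Sn≤ (+-monoʳ-≤ (3 * Sα) (*-monoʳ-≤ (K + 3) E≤2)))⟩
  3 * SA + (3 * Sα + (K + 3) * 2)    ≡⟨ lemma₂ SA Sα K ⟩
  3 * (SA + Sα) + (2 * K + 6)        ≤⟨ +-monoˡ-≤ (2 * K + 6) 3[SA+Sα]≤4K ⟩
  4 * K + (2 * K + 6)                ≡⟨ lemma₃ K ⟩
  6 + 6 * K                          ∎)
  where
  open ≤-Reasoning
  3[SA+Sα]≤4K : 3 * (SA + Sα) ≤ 4 * K
  3[SA+Sα]≤4K = +-cancelˡ-≤ 3 _ _ (≤-trans (≤-reflexive (sym (*-distribˡ-+ 3 1 (SA + Sα))))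
                                           (≤-trans (*-monoʳ-≤ 3 1+SA+Sα≤bA) 3bA≤))
  lemma₁ : ∀ K → 9 + 6 * K ≡ 3 * (3 + 2 * K)
  lemma₁ = solve-∀
  lemma₂ : ∀ SA Sα K → 3 * SA + (3 * Sα + (K + 3) * 2) ≡ 3 * (SA + Sα) + (2 * K + 6)
  lemma₂ = solve-∀
  lemma₃ : ∀ K → 4 * K + (2 * K + 6) ≡ 6 + 6 * K
  lemma₃ = solve-∀

module TreePartitionBound (K : ℕ) where

  N : ℕ
  N = 3 + 2 * K

  open Fan K N

  W : ℕ
  W = K + 3

  ends : ℕ → ℕ
  ends p = χ (does (p ℕ.≟ 0)) + χ (does (suc p ℕ.≟ N))

  two-ends : sumFrom ends 0 N ≤ 2
  two-ends = ≤-trans (≤-reflexive (sumFrom-+ (λ p → χ (does (p ℕ.≟ 0))) (λ p → χ (does (suc p ℕ.≟ N))) 0 N))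
    (+-mono-≤ (sumFrom-χ-unique (ℕ._≟ 0) (λ i≡0 j≡0 → trans i≡0 (sym j≡0)) N)
              (sumFrom-χ-unique (λ p → suc p ℕ.≟ N) (λ i+1≡N j+1≡N → suc-injective (trans i+1≡N (sym j+1≡N))) N))

  module _ (P : Partition fan) (forest : IsTreePartition P) where

    pv : V → Fin (Partition.m P)
    pv v = part P (enc v)

    A : Fin (Partition.m P)
    A = pv hub

    inBag : Fin (Partition.m P) → V → Bool
    inBag a v = does (pv v F.≟ a)

    triangle-rule : ∀ {u v w} → u ~ v → u ~ w → v ~ w → pv u ≢ pv v → pv w ≡ pv u ⊎ pv w ≡ pv v
    triangle-rule {u} {v} {w} u~v u~w v~w u≢v with pv w F.≟ pv u | pv w F.≟ pv v
    ... | yes w≡u | _       = inj₁ w≡u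
    ... | no _    | yes w≡v = inj₂ w≡v
    ... | no w≢u  | no w≢v  =
      ⊥-elim (forest⇒triangle-free (H P) forest u≢v (w≢u ∘ sym) (w≢v ∘ sym)
                                   (quotient u~v u≢v) (quotient u~w (w≢u ∘ sym)) (quotient v~w (w≢v ∘ sym)))
      where
      quotient : ∀ {x y} → x ~ y → pv x ≢ pv y → adj (H P) (pv x) (pv y) ≡ true
      quotient {x} {y} x~y x≢y = proj₂ (adjIff P (pv x) (pv y)) (x≢y , enc x , enc y , refl , refl , adj-enc x~y)

    column : Fin (Partition.m P) → Fin N → ℕ
    column a j = χ (inBag a (rim j)) + count (λ i → inBag a (ear j i))

    bagSize-columns : ∀ a → bagSize P a ≡ χ (inBag a hub) + sum (column a)
    bagSize-columns a = begin
      bagSize P a                                ≡⟨ count-cong (λ x → trans (isYes≗does (part P x F.≟ a))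
                                                                     (cong (λ y → does (part P y F.≟ a)) (sym (enc-dec x)))) ⟩
      count (inBag a ∘ dec)                      ≡⟨ count-dec (inBag a) ⟩
      χ (inBag a hub) + (count (inBag a ∘ rim) + sum (λ j → count (inBag a ∘ ear j)))
        ≡⟨ cong (χ (inBag a hub) +_) (trans (cong (_+ sum (λ j → count (inBag a ∘ ear j))) (count≡sum-χ (inBag a ∘ rim)))
                                           (sym (sum-+ (χ ∘ inBag a ∘ rim) (λ j → count (inBag a ∘ ear j))))) ⟩
      χ (inBag a hub) + sum (column a)           ∎
      where open ≡-Reasoning

    rimAt : ∀ p → p < N → V
    rimAt p p<N = rim (fromℕ< p<N)

    -- Rim positions are natural numbers; positions ≥ N carry no rim vertex and get the default value (so inA
    -- counts them as lying in A).
    onRim : ∀ {X : Set} → X → (Fin N → X) → ℕ → X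
    onRim default h p with p <? N
    ... | yes p<N = h (fromℕ< p<N)
    ... | no  _   = default

    onRim-< : ∀ {X : Set} (default : X) h {p} (p<N : p < N) → onRim default h p ≡ h (fromℕ< p<N)
    onRim-< default h {p} p<N with p <? N
    ... | yes _   = refl
    ... | no  p≮N = ⊥-elim (p≮N p<N)

    sum-onRim : ∀ (h : Fin N → ℕ) → sum h ≡ sumFrom (onRim 0 h) 0 N
    sum-onRim h = trans (sum-cong λ j → trans (cong h (sym (FP.fromℕ<-toℕ j (FP.toℕ<n j))))
                                              (sym (onRim-< 0 h (FP.toℕ<n j))))
                        (sum-toℕ {N} (onRim 0 h))

    inA : ℕ → Bool
    inA = onRim true (inBag A ∘ rim)

    inA-< : ∀ {p} (p<N : p < N) → inA p ≡ inBag A (rimAt p p<N)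
    inA-< = onRim-< true (inBag A ∘ rim)

    inA-false : ∀ {p} (p<N : p < N) → inA p ≡ false → pv (rimAt p p<N) ≢ A
    inA-false p<N notA inA′ with trans (sym (dec-true (_ F.≟ A) inA′)) (trans (sym (inA-< p<N)) notA)
    ... | ()

    inA-true : ∀ {p} (p<N : p < N) → inA p ≡ true → pv (rimAt p p<N) ≡ A
    inA-true {p} p<N isA = fromDoes {a? = pv (rimAt p p<N) F.≟ A} (trans (sym (inA-< p<N)) isA)

    consecutive : ∀ {j} (j<N : j < N) (j+1<N : suc j < N) → inA j ≡ false → inA (suc j) ≡ false →
                  pv (rimAt (suc j) j+1<N) ≡ pv (rimAt j j<N)
    consecutive j<N j+1<N notA notA′
      with triangle-rule {hub} {rimAt _ j<N} {rimAt _ j+1<N} (inj₂ tt) (inj₂ tt) (inj₁ (rim-next j<N j+1<N))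
                         (inA-false j<N notA ∘ sym)
    ... | inj₁ inA′ = ⊥-elim (inA-false j+1<N notA′ inA′)
    ... | inj₂ same = same

    run : ∀ {s e} (e≤N : e ≤ N) → (∀ j → s ≤ j → j < e → inA j ≡ false) →
          ∀ j (j<e : j < e) (s≤j : s ≤ j) →
          pv (rimAt j (<-≤-trans j<e e≤N)) ≡ pv (rimAt s (<-≤-trans (≤-<-trans s≤j j<e) e≤N))
    run e≤N notA j j<e s≤j with m≤n⇒m<n∨m≡n s≤j
    ... | inj₂ refl = refl
    run e≤N notA (suc j) j<e _ | inj₁ (s≤s s≤j) =
      trans (consecutive (<-≤-trans (<-trans (n<1+n j) j<e) e≤N) (<-≤-trans j<e e≤N)
                         (notA j s≤j (<-trans (n<1+n j) j<e)) (notA (suc j) (m≤n⇒m≤1+n s≤j) j<e))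
            (run e≤N notA j (<-trans (n<1+n j) j<e) s≤j)

    α : ℕ → ℕ
    α = onRim 0 (λ j → count (inBag A ∘ ear j))

    Boundary : ℕ → Set
    Boundary p = suc p < N × inA p ≢ inA (suc p)

    boundary? : ∀ p → Dec (Boundary p)
    boundary? p = (suc p <? N) ×-dec ¬? (inA p B.≟ inA (suc p))

    boundary : ℕ → Bool
    boundary p = does (boundary? p)

    SharedBag : Fin (Partition.m P) → ℕ → ℕ → Set
    SharedBag C p d = ∀ j (j<N : j < N) → p ≤ j → j ≤ p + d → inA j ≡ false → pv (rimAt j j<N) ≡ C

    inBag-∨ : ∀ {C D v} → pv v ≡ C ⊎ pv v ≡ D → inBag C v ∨ inBag D v ≡ true
    inBag-∨ {C} {D} {v} (inj₁ isC) = cong (_∨ inBag D v) (dec-true (pv v F.≟ C) isC)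
    inBag-∨ {C} {D} {v} (inj₂ isD) = trans (cong (inBag C v ∨_) (dec-true (pv v F.≟ D) isD)) (∨-zeroʳ _)

    ears-between : ∀ {j} (j<N : j < N) (j+1<N : suc j < N) → pv (rimAt j j<N) ≢ pv (rimAt (suc j) j+1<N) →
                   ∀ i → pv (ear (fromℕ< j<N) i) ≡ pv (rimAt j j<N) ⊎
                         pv (ear (fromℕ< j<N) i) ≡ pv (rimAt (suc j) j+1<N)
    ears-between j<N j+1<N differ i =
      triangle-rule (inj₁ (rim-next j<N j+1<N)) (inj₂ (inj₁ refl)) (inj₂ (inj₂ (rim-next j<N j+1<N))) differ

    module _ {C p d} (C≢A : C ≢ A) (shared : SharedBag C p d) {j} (p≤j : p ≤ j) (j<p+d : j < p + d) (j<N : j < N) where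

      private
        jf : Fin N
        jf = fromℕ< j<N

      rim-in-C : χ (not (inA j)) ≤ χ (inBag C (rim jf))
      rim-in-C with inA j in inA-j
      ... | true  = z≤n
      ... | false = ≤-reflexive (cong χ (sym (dec-true (pv (rim jf) F.≟ C) (shared j j<N p≤j (<⇒≤ j<p+d) inA-j))))

      boundary-ends : (j+1<N : suc j < N) → inA j ≢ inA (suc j) →
                      (pv (rim jf) ≡ A × pv (rimAt (suc j) j+1<N) ≡ C) ⊎
                      (pv (rim jf) ≡ C × pv (rimAt (suc j) j+1<N) ≡ A)
      boundary-ends j+1<N differ with inA j in inA-j | inA (suc j) in inA-j+1
      ... | true  | false = inj₁ (inA-true j<N inA-j , shared (suc j) j+1<N (m≤n⇒m≤1+n p≤j) j<p+d inA-j+1)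
      ... | false | true  = inj₂ (shared j j<N p≤j (<⇒≤ j<p+d) inA-j , inA-true j+1<N inA-j+1)
      ... | true  | true  = ⊥-elim (differ refl)
      ... | false | false = ⊥-elim (differ refl)

      ears-in-C-or-A : Boundary j → ∀ i → pv (ear jf i) ≡ C ⊎ pv (ear jf i) ≡ A
      ears-in-C-or-A (j+1<N , differ) i with boundary-ends j+1<N differ
      ... | inj₁ (isA , isC) with ears-between j<N j+1<N (λ e → C≢A (trans (sym isC) (trans (sym e) isA))) i
      ...   | inj₁ e = inj₂ (trans e isA)
      ...   | inj₂ e = inj₁ (trans e isC)
      ears-in-C-or-A (j+1<N , differ) i | inj₂ (isC , isA)
        with ears-between j<N j+1<N (λ e → C≢A (trans (sym isC) (trans e isA))) i
      ...   | inj₁ e = inj₁ (trans e isC)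
      ...   | inj₂ e = inj₂ (trans e isA)

      ears-count : Boundary j → K ≤ count (inBag C ∘ ear jf) + count (inBag A ∘ ear jf)
      ears-count bd = begin
        K                                                    ≡⟨ sym (trans (count-const {K} true) (*-identityʳ K)) ⟩
        count {K} (λ _ → true)                               ≤⟨ count-mono (λ i _ → inBag-∨ {v = ear jf i} (ears-in-C-or-A bd i)) ⟩
        count (λ i → inBag C (ear jf i) ∨ inBag A (ear jf i)) ≤⟨ count-∨ (inBag C ∘ ear jf) (inBag A ∘ ear jf) ⟩
        count (inBag C ∘ ear jf) + count (inBag A ∘ ear jf)  ∎
        where open ≤-Reasoning

      nonA≤column : χ (not (inA j)) ≤ onRim 0 (column C) j
      nonA≤column = ≤-trans rim-in-C (≤-trans (m≤m+n _ _) (≤-reflexive (sym (onRim-< 0 (column C) j<N))))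

      nonA+boundary≤column : χ (not (inA j)) + K * χ (boundary j) ≤ onRim 0 (column C) j + χ (boundary j) * α j
      nonA+boundary≤column rewrite onRim-< 0 (column C) j<N | onRim-< 0 (λ j → count (inBag A ∘ ear j)) j<N =
        ≤-trans (+-mono-≤ rim-in-C (ears (boundary? j))) (≤-reflexive (sym (+-assoc (χ (inBag C (rim jf))) _ _)))
        where
        ears : (bd? : Dec (Boundary j)) →
               K * χ (does bd?) ≤ count (inBag C ∘ ear jf) + χ (does bd?) * count (inBag A ∘ ear jf)
        ears (no  _)  = ≤-trans (≤-reflexive (*-zeroʳ K)) z≤n
        ears (yes bd) = ≤-trans (≤-reflexive (*-identityʳ K))
                          (≤-trans (ears-count bd)
                                   (+-monoʳ-≤ (count (inBag C ∘ ear jf)) (≤-reflexive (sym (*-identityˡ _)))))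

    shared-run : ∀ {p d s} (s<p+d : s < p + d) (p+d≤N : p + d ≤ N) →
                 (∀ j → p ≤ j → j < s → inA j ≡ true) → (∀ j → s ≤ j → j < p + d → inA j ≡ false) →
                 (p + d < N → inA (p + d) ≡ true) → SharedBag (pv (rimAt s (<-≤-trans s<p+d p+d≤N))) p d
    shared-run {p} {d} {s} s<p+d p+d≤N isA-before notA-after isA-after j j<N p≤j j≤p+d notA
      with m≤n⇒m<n∨m≡n j≤p+d
    ... | inj₂ refl = ⊥-elim (true≢false (trans (sym (isA-after j<N)) notA))
    ... | inj₁ j<p+d with j <? s
    ...   | yes j<s = ⊥-elim (true≢false (trans (sym (isA-before j p≤j j<s)) notA))
    ...   | no  j≮s = run p+d≤N notA-after j j<p+d (≮⇒≥ j≮s)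

    nonA : ℕ → ℕ
    nonA p = χ (not (inA p))

    Aears : ℕ → ℕ
    Aears p = χ (boundary p) * α p

    segment-columns : ∀ {C p d} → C ≢ A → SharedBag C p d → p + d ≤ N →
                      sumFrom nonA p d ≤ bagSize P C ×
                      sumFrom nonA p d + K * sumFrom (χ ∘ boundary) p d ≤ bagSize P C + sumFrom Aears p d
    segment-columns {C} {p} {d} C≢A shared p+d≤N =
      ≤-trans (sumFrom-mono-≤ p d λ j p≤j j< → nonA≤column C≢A shared p≤j j< (<-≤-trans j< p+d≤N)) columns≤ ,
      (begin
        sumFrom nonA p d + K * sumFrom (χ ∘ boundary) p d ≡⟨ sym (trans (sumFrom-+ nonA _ p d)
                                                                    (cong (sumFrom nonA p d +_) (sumFrom-*ˡ K (χ ∘ boundary) p d))) ⟩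
        sumFrom (λ j → nonA j + K * χ (boundary j)) p d
          ≤⟨ sumFrom-mono-≤ p d (λ j p≤j j< → nonA+boundary≤column C≢A shared p≤j j< (<-≤-trans j< p+d≤N)) ⟩
        sumFrom (λ j → onRim 0 (column C) j + Aears j) p d ≡⟨ sumFrom-+ (onRim 0 (column C)) Aears p d ⟩
        sumFrom (onRim 0 (column C)) p d + sumFrom Aears p d ≤⟨ +-monoˡ-≤ _ columns≤ ⟩
        bagSize P C + sumFrom Aears p d                     ∎)
      where
      open ≤-Reasoning
      columns≤ : sumFrom (onRim 0 (column C)) p d ≤ bagSize P C
      columns≤ = begin
        sumFrom (onRim 0 (column C)) p d ≤⟨ sumFrom-inside (onRim 0 (column C)) {p} {d} N p+d≤N ⟩
        sumFrom (onRim 0 (column C)) 0 N ≡⟨ sym (sum-onRim (column C)) ⟩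
        sum (column C)                   ≤⟨ m≤n+m _ (χ (inBag C hub)) ⟩
        χ (inBag C hub) + sum (column C) ≡⟨ sym (bagSize-columns C) ⟩
        bagSize P C                      ∎

    rim-split : sumFrom (χ ∘ inA) 0 N + sumFrom nonA 0 N ≡ N
    rim-split = begin
      sumFrom (χ ∘ inA) 0 N + sumFrom nonA 0 N           ≡⟨ sym (sumFrom-+ (χ ∘ inA) nonA 0 N) ⟩
      sumFrom (λ j → χ (inA j) + χ (not (inA j))) 0 N   ≡⟨ sumFrom-cong 0 N (λ j → one-of (inA j)) ⟩
      sumFrom (λ _ → 1) 0 N                             ≡⟨ trans (sumFrom-const 1 0 N) (*-identityʳ N) ⟩
      N                                                 ∎
      where
      open ≡-Reasoning
      one-of : ∀ b → χ b + χ (not b) ≡ 1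
      one-of true  = refl
      one-of false = refl

    hub-rim-and-ears : 1 + (sumFrom (χ ∘ inA) 0 N + sumFrom Aears 0 N) ≤ bagSize P A
    hub-rim-and-ears = begin
      1 + (sumFrom (χ ∘ inA) 0 N + sumFrom Aears 0 N)     ≡⟨ cong₂ _+_ (cong χ (sym (dec-true (A F.≟ A) refl)))
                                                                         (sym (sumFrom-+ (χ ∘ inA) Aears 0 N)) ⟩
      χ (inBag A hub) + sumFrom (λ j → χ (inA j) + Aears j) 0 N
                                                          ≤⟨ +-monoʳ-≤ (χ (inBag A hub)) (sumFrom-mono-≤ 0 N column-A) ⟩
      χ (inBag A hub) + sumFrom (onRim 0 (column A)) 0 N ≡⟨ cong (χ (inBag A hub) +_) (sym (sum-onRim (column A))) ⟩
      χ (inBag A hub) + sum (column A)                    ≡⟨ sym (bagSize-columns A) ⟩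
      bagSize P A                                         ∎
      where
      open ≤-Reasoning
      χ*≤ : ∀ b x → χ b * x ≤ x
      χ*≤ true  x = ≤-reflexive (*-identityˡ x)
      χ*≤ false x = z≤n
      column-A : ∀ j → 0 ≤ j → j < 0 + N → χ (inA j) + Aears j ≤ onRim 0 (column A) j
      column-A j _ j<N = begin
        χ (inA j) + Aears j                               ≡⟨ cong (λ b → χ b + Aears j) (inA-< j<N) ⟩
        χ (inBag A (rimAt j j<N)) + χ (boundary j) * α j  ≤⟨ +-monoʳ-≤ (χ (inBag A (rimAt j j<N)))
                                                               (≤-trans (χ*≤ (boundary j) (α j))
                                                                        (≤-reflexive (onRim-< 0 (λ j → count (inBag A ∘ ear j)) j<N))) ⟩
        column A (fromℕ< j<N)                             ≡⟨ sym (onRim-< 0 (column A) j<N) ⟩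
        onRim 0 (column A) j                              ∎

    module _ (2≤K : 2 ≤ K) (small : ∀ a → 3 * bagSize P a ≤ 3 + 4 * K) where

      -- A segment runs from a rim vertex in A (or from r₀) up to the next one; its rim vertices outside A share
      -- a bag C.  Three times their number is paid by the A-ears at its boundaries and by W = K + 3 for each end
      -- of the rim inside it, since 3|C| ≤ 3 + 4K while 3K + W and 2 · 3K are both at least 3 + 4K.
      f g : ℕ → ℕ
      f p = 3 * nonA p
      g p = 3 * Aears p + W * ends p

      trade : ∀ {C p d} → C ≢ A → SharedBag C p d → p + d ≤ N →
              3 + 4 * K ≤ 3 * (K * sumFrom (χ ∘ boundary) p d) + W * sumFrom ends p d →
              sumFrom f p d ≤ sumFrom g p d
      trade {C} {p} {d} C≢A shared p+d≤N enough = begin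
        sumFrom f p d                                   ≡⟨ sumFrom-*ˡ 3 nonA p d ⟩
        3 * sumFrom nonA p d
          ≤⟨ trade-boundaries K W {c = bagSize P C} (proj₂ (segment-columns C≢A shared p+d≤N)) (small C) enough ⟩
        3 * sumFrom Aears p d + W * sumFrom ends p d
          ≡⟨ sym (trans (sumFrom-+ (λ j → 3 * Aears j) (λ j → W * ends j) p d)
                        (cong₂ _+_ (sumFrom-*ˡ 3 Aears p d) (sumFrom-*ˡ W ends p d))) ⟩
        sumFrom g p d                                   ∎
        where open ≤-Reasoning

      open Segments N inA using (Segment; marked-end; segment-sum)

      boundary-true : ∀ {p a b} → suc p < N → inA p ≡ a → inA (suc p) ≡ b → a ≢ b → boundary p ≡ true
      boundary-true p+1<N refl refl a≢b = dec-true (boundary? _) (p+1<N , a≢b)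

      no-bag-holds-rim : ∀ {C} → N ≤ bagSize P C → ⊥
      no-bag-holds-rim {C} N≤C = <⇒≱ (≤-<-trans (small C) 3+4K<3N) (*-monoʳ-≤ 3 N≤C)
        where
        3+4K<3N : 3 + 4 * K < 3 * N
        3+4K<3N = ≤-trans (+-mono-≤ (m≤m+n 4 5) (*-monoˡ-≤ K (m≤m+n 4 2))) (≤-reflexive (lemma K))
          where
          lemma : ∀ K → 9 + 6 * K ≡ 3 * (3 + 2 * K)
          lemma = solve-∀

      marked-start : ∀ {p d} → Segment p d → inA p ≡ true → sumFrom f p d ≤ sumFrom g p d
      marked-start {p} {suc zero} _ isA = ≤-trans (≤-reflexive (cong (λ b → 3 * χ (not b) + 0) isA)) z≤n
      marked-start {p} {suc (suc e)} S isA = trade C≢A shared inside (weights (p + d <? N))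
        where
        open Segment S
        d last : ℕ
        d = suc (suc e)
        last = p + suc e
        last+1≡p+d : suc last ≡ p + d
        last+1≡p+d = sym (+-suc p (suc e))
        p<last : p < last
        p<last = subst (p <_) (sym (+-suc p e)) (s≤s (m≤m+n p e))
        last<p+d : last < p + d
        last<p+d = ≤-reflexive last+1≡p+d
        p+1<p+d : suc p < p + d
        p+1<p+d = ≤-<-trans p<last last<p+d
        isA-before : ∀ j → p ≤ j → j < suc p → inA j ≡ true
        isA-before j p≤j (s≤s j≤p) rewrite ≤-antisym j≤p p≤j = isA
        shared : SharedBag (pv (rimAt (suc p) (<-≤-trans p+1<p+d inside))) p d
        shared = shared-run p+1<p+d inside isA-before unmarked (marked-end S)
        C≢A : pv (rimAt (suc p) (<-≤-trans p+1<p+d inside)) ≢ A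
        C≢A = inA-false (<-≤-trans p+1<p+d inside) (unmarked (suc p) ≤-refl p+1<p+d)
        p-boundary : boundary p ≡ true
        p-boundary = boundary-true (<-≤-trans p+1<p+d inside) isA (unmarked (suc p) ≤-refl p+1<p+d) true≢false
        weights : Dec (p + d < N) → 3 + 4 * K ≤ 3 * (K * sumFrom (χ ∘ boundary) p d) + W * sumFrom ends p d
        weights (yes p+d<N) = two-boundaries W (sumFrom ends p d) 2≤K
          (≤-trans (≤-reflexive (sym (cong₂ (λ x y → χ x + χ y) p-boundary last-boundary)))
                   (two-terms≤sumFrom (χ ∘ boundary) ≤-refl p<last last<p+d))
          where
          last-boundary : boundary last ≡ true
          last-boundary = boundary-true (subst (_< N) (sym last+1≡p+d) p+d<N) (unmarked last p<last last<p+d)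
                                        (trans (cong inA last+1≡p+d) (marked-end S p+d<N)) (true≢false ∘ sym)
        weights (no p+d≮N) = boundary-and-end K
          (≤-trans (≤-reflexive (cong χ (sym p-boundary))) (term≤sumFrom (χ ∘ boundary) ≤-refl (<-trans p<last last<p+d)))
          (≤-trans (≤-trans (≤-reflexive (cong χ (sym last-end))) (m≤n+m _ _)) (term≤sumFrom ends (<⇒≤ p<last) last<p+d))
          where
          last-end : does (suc last ℕ.≟ N) ≡ true
          last-end = dec-true (suc last ℕ.≟ N) (trans last+1≡p+d (≤-antisym inside (≮⇒≥ p+d≮N)))

      unmarked-start : ∀ {d} → Segment 0 d → inA 0 ≡ false → sumFrom f 0 d ≤ sumFrom g 0 d
      unmarked-start {suc e} S notA₀ = by-length (suc e <? N)
        where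
        open Segment S
        d : ℕ
        d = suc e
        notA-all : ∀ j → 0 ≤ j → j < d → inA j ≡ false
        notA-all zero    _ _   = notA₀
        notA-all (suc j) _ j<d = unmarked (suc j) (s≤s z≤n) j<d
        0<N : 0 < N
        0<N = s≤s z≤n
        shared : SharedBag (pv (rimAt 0 0<N)) 0 d
        shared = shared-run {0} {d} {0} (s≤s z≤n) inside (λ _ _ ()) notA-all (marked-end S)
        C≢A : pv (rimAt 0 0<N) ≢ A
        C≢A = inA-false 0<N notA₀
        by-length : Dec (d < N) → sumFrom f 0 d ≤ sumFrom g 0 d
        by-length (yes d<N) = trade C≢A shared inside (boundary-and-end K
          (≤-trans (≤-reflexive (cong χ (sym last-boundary))) (term≤sumFrom (χ ∘ boundary) {0} {d} {e} z≤n ≤-refl))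
          (≤-trans (m≤m+n 1 _) (term≤sumFrom ends {0} {d} {0} z≤n (s≤s z≤n))))
          where
          last-boundary : boundary e ≡ true
          last-boundary = boundary-true d<N (notA-all e z≤n ≤-refl) (marked-end S d<N) (true≢false ∘ sym)
        by-length (no d≮N) = ⊥-elim (no-bag-holds-rim (begin
          N                     ≡⟨ sym (trans (sumFrom-const 1 0 N) (*-identityʳ N)) ⟩
          sumFrom (λ _ → 1) 0 N ≡⟨ cong (sumFrom (λ _ → 1) 0) (sym d≡N) ⟩
          sumFrom (λ _ → 1) 0 d ≤⟨ sumFrom-mono-≤ 0 d (λ j _ j<d → ≤-reflexive (cong (χ ∘ not) (sym (notA-all j z≤n j<d))))⟩
          sumFrom nonA 0 d      ≤⟨ proj₁ (segment-columns {p = 0} {d} C≢A shared inside) ⟩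
          bagSize P _           ∎))
          where
          open ≤-Reasoning
          d≡N : d ≡ N
          d≡N = ≤-antisym inside (≮⇒≥ d≮N)

      segment-bound : ∀ {p d} → Segment p d → sumFrom f p d ≤ sumFrom g p d
      segment-bound {p} S with inA p in inA-p | Segment.start S
      ... | true  | _         = marked-start S inA-p
      ... | false | inj₁ refl = unmarked-start S inA-p

      no-small-bags : ⊥
      no-small-bags = rim-too-long K {SA = sumFrom (χ ∘ inA) 0 N} {Sα = sumFrom Aears 0 N} rim-split
        (subst₂ _≤_ (sumFrom-*ˡ 3 nonA 0 N)
                    (trans (sumFrom-+ (λ j → 3 * Aears j) (λ j → W * ends j) 0 N)
                           (cong₂ _+_ (sumFrom-*ˡ 3 Aears 0 N) (sumFrom-*ˡ W ends 0 N)))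
                    (segment-sum f g segment-bound))
        two-ends hub-rim-and-ears (small A)

  tree-partition-bound : 2 ≤ K → ∀ (P : Partition fan) → IsTreePartition P →
                         ∃ λ a → 4 + 4 * K ≤ 3 * bagSize P a
  tree-partition-bound 2≤K P forest with FP.any? (λ a → 4 + 4 * K ≤? 3 * bagSize P a)
  ... | yes big  = big
  ... | no  none = ⊥-elim (no-small-bags P forest 2≤K (λ a → ≤-pred (≰⇒> (λ big → none (a , big)))))

odd⇒3+2K : ∀ Δ → 11 ≤ Δ → Δ % 2 ≡ 1 → ∃ λ K → Δ ≡ 3 + 2 * K × 2 ≤ K
odd⇒3+2K Δ 11≤Δ Δ%2≡1 = from-half (Δ / 2) (trans (m≡m%n+[m/n]*n Δ 2) (cong (_+ Δ / 2 * 2) Δ%2≡1))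
  where
  from-half : ∀ h → Δ ≡ 1 + h * 2 → ∃ λ K → Δ ≡ 3 + 2 * K × 2 ≤ K
  from-half (suc (suc (suc k))) Δ≡ = suc (suc k) , trans Δ≡ (lemma k) , s≤s (s≤s z≤n)
    where
    lemma : ∀ k → 1 + (3 + k) * 2 ≡ 3 + 2 * (2 + k)
    lemma = solve-∀
  from-half 0 Δ≡ with subst (11 ≤_) Δ≡ 11≤Δ
  ... | s≤s ()
  from-half 1 Δ≡ with subst (11 ≤_) Δ≡ 11≤Δ
  ... | s≤s (s≤s (s≤s ()))
  from-half 2 Δ≡ with subst (11 ≤_) Δ≡ 11≤Δ
  ... | s≤s (s≤s (s≤s (s≤s (s≤s ()))))

theorem7 : ∀ (Δ : ℕ) → 11 ≤ Δ → Δ % 2 ≡ 1 →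
    Σ ℕ λ n → Σ (Graph n) λ G →
      Chordal G × HasTreewidth G 2 × MaxDegree G Δ ×
      (∀ (P : Partition G) → IsTreePartition P →
         ∃ λ a → 2 * (Δ ∸ 1) ≤ 3 * bagSize P a)
theorem7 Δ 11≤Δ Δ-odd with odd⇒3+2K Δ 11≤Δ Δ-odd
... | K , refl , 2≤K =
  n , fan , fan-chordal , fan-treewidth 2≤Δ , fan-maxDegree ≤-refl ,
  λ P tree-partition →
    map₂ (λ {a} → subst (_≤ 3 * bagSize P a) (lemma K)) (tree-partition-bound 2≤K P tree-partition)
  where
  open Fan K (3 + 2 * K)
  open TreePartitionBound K
  2≤Δ : 2 ≤ 3 + 2 * K
  2≤Δ = ≤-trans (s≤s (s≤s z≤n)) (m≤m+n 3 (2 * K))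
  lemma : ∀ K → 4 + 4 * K ≡ 2 * (2 + 2 * K)
  lemma = solve-∀
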